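{- For each $k\in\{5,6,7\}$, the formal power series \[ F_{k,1}(q)=\sum_{n\ge 0}\frac{\left(q^{2n+2};q^2\right)_\infty\left(q^{2n+2k};q^2\right)_\infty}{\left(q^{2n+1};q^2\right)_\infty^2}\,q^{2n+1} \] has nonnegative coefficients, i.e. writing $F_{k,1}(q)=\sum_{n\ge0}c_{k,1}(n)q^n$, we have $c_{k,1}(n)\ge 0$ for all $n\in\mathbb{N}_0$.
   Context: For $n\in\mathbb{N}_0\cup\{\infty\}$, $(a;q)_n:=\prod_{j=0}^{n-1}(1-aq^j)$. The series $F_{k,1}(q)$ is regarded as a formal power series in $q$ (equivalently, an analytic function for $|q|<1$). -}

module Defs where

open import Data.Nat using (ℕ; zero; suc; _+_; _*_; _∸_)
import Data.Nat as ℕ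
open import Data.Nat.Divisibility using (_∣?_)
open import Data.Integer using (ℤ; +_; _-_) renaming (_+_ to _+ℤ_; _*_ to _*ℤ_)
open import Relation.Nullary using (Dec; yes; no)

-- Formal power series in q with integer coefficients: n ↦ coefficient of q^n.
Series : Set
Series = ℕ → ℤ

ind : {P : Set} → Dec P → ℤ
ind (yes _) = + 1
ind (no _)  = + 0

sumUpTo : (ℕ → ℤ) → ℕ → ℤ
sumUpTo f zero    = f zero
sumUpTo f (suc m) = sumUpTo f m +ℤ f (suc m)

_⊛_ : Series → Series → Series
(f ⊛ g) m = sumUpTo (λ i → f i *ℤ g (m ∸ i)) m
infixl 7 _⊛_

oneS : Series
oneS i = ind (i ℕ.≟ 0)

mono : ℕ → Series
mono e i = ind (i ℕ.≟ e)

oneMinus : ℕ → Series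
oneMinus e i = oneS i - mono e i

-- 1 / (1 - q^e) = Σ_{t ≥ 0} q^{e t}   (used only for e ≥ 1)
geom : ℕ → Series
geom e i = ind (e ∣? i)

finProd : (ℕ → Series) → ℕ → Series
finProd fs zero    = oneS
finProd fs (suc N) = finProd fs N ⊛ fs N

-- (q^s ; q^2)_∞ = ∏_{j ≥ 0} (1 - q^{s+2j}), for s ≥ 1.
-- The coefficient of q^m only involves the factors with j ≤ m
-- (the others are ≡ 1 mod q^{m+1}), so it equals the coefficient of
-- the finite product over j < m+1.
pochInf : ℕ → Series
pochInf s m = finProd (λ j → oneMinus (s + 2 * j)) (suc m) m

-- 1 / (q^s ; q^2)_∞ = ∏_{j ≥ 0} 1/(1 - q^{s+2j}), for s ≥ 1 (same truncation).
invPochInf : ℕ → Series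
invPochInf s m = finProd (λ j → geom (s + 2 * j)) (suc m) m

Fterm : ℕ → ℕ → Series
Fterm k n = pochInf (2 * n + 2) ⊛ pochInf (2 * n + 2 * k)
            ⊛ invPochInf (2 * n + 1) ⊛ invPochInf (2 * n + 1)
            ⊛ mono (2 * n + 1)

-- c_{k,1}(m): coefficient of q^m in F_{k,1}(q) = Σ_{n ≥ 0} Fterm k n.
-- Fterm k n is divisible by q^{2n+1}, so only n ≤ m contribute.
c : ℕ → ℕ → ℤ
c k m = sumUpTo (λ n → Fterm k n m) m

-- Write X for q^(2n). For each k there are a polynomial σ(q, X) and a product
-- d(q) = ∏ (1 - q^e) over a finite list of exponents such that
--   σ(X) (1 - q²X) (1 - q^(2k)X) - σ(q²X) (1 - qX)² = d · qX (1 - q²X) (1 - q^(2k)X).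
-- Multiplied by the infinite products, this says that d times the n-th summand of F_{k,1}
-- is V n - V (n+1), where V n = σ(q^(2n)) (q^(2n+2);q²)_∞ (q^(2n+2k);q²)_∞ / (q^(2n+1);q²)_∞².
-- As σ(q, 1) = 0 and V n → σ(q, 0) = σ₀(q), the sum telescopes to F_{k,1} = -σ₀ / d.
-- Pairing -σ₀ with one factor 1/(1 - q^e) of 1/d gives a series that is e-periodic beyond
-- the degree of σ₀, hence nonnegative once its first period is; the remaining factors
-- 1/(1 - q^e′) have nonnegative coefficients. The polynomial identities and the finite
-- check are verified by evaluation.

module Submission where

open import Level using (0ℓ)
open import Data.Nat using (ℕ; zero; suc)
open import Data.List using (List; []; _∷_; map; foldr)
open import Data.List.Relation.Unary.All using (All; []; _∷_)
open import Relation.Binary.PropositionalEquality using (_≡_)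
open import Algebra.Bundles using (RawRing; CommutativeMonoid)
open import Algebra.Solver.Ring.AlmostCommutativeRing
  using (AlmostCommutativeRing; _-Raw-AlmostCommutative⟶_)

-- Polynomials and Horner evaluation

module Polynomial (R : RawRing 0ℓ 0ℓ) where
  open RawRing R

  -- Coefficient lists, constant term first.
  Poly : Set
  Poly = List Carrier

  infixl 6 _+ₚ_
  infixl 7 _*ₚ_ _·ₚ_

  _+ₚ_ : Poly → Poly → Poly
  []      +ₚ q       = q
  (a ∷ p) +ₚ []      = a ∷ p
  (a ∷ p) +ₚ (b ∷ q) = a + b ∷ p +ₚ q

  _·ₚ_ : Carrier → Poly → Poly
  c ·ₚ p = map (c *_) p

  -ₚ_ : Poly → Poly
  -ₚ_ = map -_

  _*ₚ_ : Poly → Poly → Poly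
  []      *ₚ q = []
  (a ∷ p) *ₚ q = a ·ₚ q +ₚ (0# ∷ p *ₚ q)

  polyRawRing : RawRing 0ℓ 0ℓ
  polyRawRing = record
    { Carrier = Poly ; _≈_ = _≡_ ; _+_ = _+ₚ_ ; _*_ = _*ₚ_ ; -_ = -ₚ_ ; 0# = [] ; 1# = 1# ∷ [] }

  X^ : ℕ → Poly
  X^ zero    = 1# ∷ []
  X^ (suc n) = 0# ∷ X^ n

  sumCoeffs : Poly → Carrier
  sumCoeffs = foldr _+_ 0#

  dilate : Carrier → Poly → Poly
  dilate c []      = []
  dilate c (a ∷ p) = a ∷ c ·ₚ dilate c p

module Horner {R : RawRing 0ℓ 0ℓ} {S : AlmostCommutativeRing 0ℓ 0ℓ}
              (φ : R -Raw-AlmostCommutative⟶ S) where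
  open Polynomial R
  private module R = RawRing R
  open AlmostCommutativeRing S
  open _-Raw-AlmostCommutative⟶_ φ
  open import Relation.Binary.Reasoning.Setoid setoid
  open import Algebra.Properties.CommutativeSemigroup
    (CommutativeMonoid.commutativeSemigroup +-commutativeMonoid) using (interchange)
  open import Algebra.Properties.CommutativeSemigroup *-commutativeSemigroup using (x∙yz≈y∙xz)

  eval : Carrier → Poly → Carrier
  eval x []      = 0#
  eval x (a ∷ p) = ⟦ a ⟧ + x * eval x p

  module _ (x : Carrier) where

    eval-+ : ∀ p q → eval x (p +ₚ q) ≈ eval x p + eval x q
    eval-+ []      q       = sym (+-identityˡ (eval x q))
    eval-+ (a ∷ p) []      = sym (+-identityʳ (eval x (a ∷ p)))
    eval-+ (a ∷ p) (b ∷ q) = begin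
      ⟦ a R.+ b ⟧ + x * eval x (p +ₚ q)
        ≈⟨ +-cong (+-homo a b) (*-cong refl (eval-+ p q)) ⟩
      ⟦ a ⟧ + ⟦ b ⟧ + x * (eval x p + eval x q)
        ≈⟨ +-cong refl (distribˡ x (eval x p) (eval x q)) ⟩
      ⟦ a ⟧ + ⟦ b ⟧ + (x * eval x p + x * eval x q)
        ≈⟨ interchange ⟦ a ⟧ ⟦ b ⟧ _ _ ⟩
      eval x (a ∷ p) + eval x (b ∷ q) ∎

    eval-· : ∀ c p → eval x (c ·ₚ p) ≈ ⟦ c ⟧ * eval x p
    eval-· c []      = sym (zeroʳ ⟦ c ⟧)
    eval-· c (a ∷ p) = begin
      ⟦ c R.* a ⟧ + x * eval x (c ·ₚ p)   ≈⟨ +-cong (*-homo c a) (*-cong refl (eval-· c p)) ⟩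
      ⟦ c ⟧ * ⟦ a ⟧ + x * (⟦ c ⟧ * eval x p)   ≈⟨ +-cong refl (x∙yz≈y∙xz x ⟦ c ⟧ (eval x p)) ⟩
      ⟦ c ⟧ * ⟦ a ⟧ + ⟦ c ⟧ * (x * eval x p)   ≈⟨ sym (distribˡ ⟦ c ⟧ ⟦ a ⟧ _) ⟩
      ⟦ c ⟧ * eval x (a ∷ p)               ∎

    eval-neg : ∀ p → eval x (-ₚ p) ≈ - eval x p
    eval-neg []      = begin
      0#          ≈⟨ sym (zeroʳ (- 0#)) ⟩
      - 0# * 0#   ≈⟨ -‿*-distribˡ 0# 0# ⟩
      - (0# * 0#) ≈⟨ -‿cong (zeroˡ 0#) ⟩
      - 0#        ∎
    eval-neg (a ∷ p) = begin
      ⟦ R.- a ⟧ + x * eval x (-ₚ p)   ≈⟨ +-cong (-‿homo a) (*-cong refl (eval-neg p)) ⟩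
      - ⟦ a ⟧ + x * - eval x p        ≈⟨ +-cong refl (trans (*-comm x _) (-‿*-distribˡ (eval x p) x)) ⟩
      - ⟦ a ⟧ + - (eval x p * x)      ≈⟨ +-cong refl (-‿cong (*-comm (eval x p) x)) ⟩
      - ⟦ a ⟧ + - (x * eval x p)      ≈⟨ -‿+-comm ⟦ a ⟧ (x * eval x p) ⟩
      - eval x (a ∷ p)                ∎

    eval-* : ∀ p q → eval x (p *ₚ q) ≈ eval x p * eval x q
    eval-* []      q = sym (zeroˡ (eval x q))
    eval-* (a ∷ p) q = begin
      eval x (a ·ₚ q +ₚ (R.0# ∷ p *ₚ q))
        ≈⟨ eval-+ (a ·ₚ q) (R.0# ∷ p *ₚ q) ⟩
      eval x (a ·ₚ q) + (⟦ R.0# ⟧ + x * eval x (p *ₚ q))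
        ≈⟨ +-cong (eval-· a q) (+-cong 0-homo (*-cong refl (eval-* p q))) ⟩
      ⟦ a ⟧ * eval x q + (0# + x * (eval x p * eval x q))
        ≈⟨ +-cong refl (+-identityˡ _) ⟩
      ⟦ a ⟧ * eval x q + x * (eval x p * eval x q)
        ≈⟨ +-cong refl (sym (*-assoc x (eval x p) (eval x q))) ⟩
      ⟦ a ⟧ * eval x q + x * eval x p * eval x q
        ≈⟨ sym (distribʳ (eval x q) ⟦ a ⟧ _) ⟩
      eval x (a ∷ p) * eval x q ∎

    eval-const : ∀ a → eval x (a ∷ []) ≈ ⟦ a ⟧
    eval-const a = trans (+-cong refl (zeroʳ x)) (+-identityʳ ⟦ a ⟧)

    eval-hom : polyRawRing -Raw-AlmostCommutative⟶ S
    eval-hom = record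
      { ⟦_⟧ = eval x
      ; +-homo = eval-+
      ; *-homo = eval-*
      ; -‿homo = eval-neg
      ; 0-homo = refl
      ; 1-homo = trans (eval-const R.1#) 1-homo }

    eval-vanishes : ∀ {P : R.Carrier → Set} → (∀ {a} → P a → ⟦ a ⟧ ≈ 0#) → ∀ {p} → All P p → eval x p ≈ 0#
    eval-vanishes P⇒0 []         = refl
    eval-vanishes P⇒0 {a ∷ p} (Pa ∷ Pp) = begin
      ⟦ a ⟧ + x * eval x p   ≈⟨ +-cong (P⇒0 Pa) (*-cong refl (eval-vanishes P⇒0 Pp)) ⟩
      0# + x * 0#            ≈⟨ trans (+-identityˡ _) (zeroʳ x) ⟩
      0#                     ∎

  eval-cong : ∀ {x y} → x ≈ y → ∀ p → eval x p ≈ eval y p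
  eval-cong x≈y []      = refl
  eval-cong x≈y (a ∷ p) = +-cong refl (*-cong x≈y (eval-cong x≈y p))

  eval-dilate : ∀ c x p → eval x (dilate c p) ≈ eval (⟦ c ⟧ * x) p
  eval-dilate c x []      = refl
  eval-dilate c x (a ∷ p) = +-cong refl (begin
    x * eval x (c ·ₚ dilate c p)         ≈⟨ *-cong refl (eval-· x c (dilate c p)) ⟩
    x * (⟦ c ⟧ * eval x (dilate c p))    ≈⟨ *-cong refl (*-cong refl (eval-dilate c x p)) ⟩
    x * (⟦ c ⟧ * eval (⟦ c ⟧ * x) p)    ≈⟨ sym (*-assoc x ⟦ c ⟧ _) ⟩
    x * ⟦ c ⟧ * eval (⟦ c ⟧ * x) p      ≈⟨ *-cong (*-comm x ⟦ c ⟧) refl ⟩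
    ⟦ c ⟧ * x * eval (⟦ c ⟧ * x) p       ∎)

  eval-one : ∀ p → eval 1# p ≈ ⟦ sumCoeffs p ⟧
  eval-one []      = sym 0-homo
  eval-one (a ∷ p) = begin
    ⟦ a ⟧ + 1# * eval 1# p     ≈⟨ +-cong refl (trans (*-identityˡ _) (eval-one p)) ⟩
    ⟦ a ⟧ + ⟦ sumCoeffs p ⟧    ≈⟨ sym (+-homo a (sumCoeffs p)) ⟩
    ⟦ a R.+ sumCoeffs p ⟧      ∎

-- Formal power series

open import Defs
open import Data.List using (length; upTo)
open import Data.List.Relation.Unary.All as All using (all?)
open import Data.List.Relation.Unary.All.Properties using (applyUpTo⁻)
open import Data.Nat as ℕ using (_+_; _*_; _∸_; z≤n; s≤s; NonZero)
open import Data.Nat.Divisibility using (_∣?_; _∣0; ∣⇒≤; ∣-refl; ∣m∣n⇒∣m+n; ∣m+n∣m⇒∣n)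
import Data.Nat.Properties as ℕP
open import Data.Nat.Induction using (<-rec)
open import Data.Integer as ℤ using (ℤ; +_; -[1+_]; -_; _≤_; +≤+) renaming (_+_ to _+ℤ_; _*_ to _*ℤ_)
import Data.Integer.Properties as ℤP
open import Algebra.Properties.CommutativeSemigroup ℤP.+-commutativeSemigroup using (interchange)
open import Data.Maybe using (Maybe; just; nothing)
open import Data.Product using (_,_)
open import Data.Sum using (_⊎_; inj₁; inj₂)
open import Function using (_∘_; id)
open import Relation.Nullary using (Dec; yes; no; ¬_; contradiction)
open import Relation.Nullary.Decidable using (True; toWitness)
open import Relation.Binary using (Rel)
import Relation.Binary.Reasoning.Setoid
open import Relation.Binary.PropositionalEquality
  using (_≢_; refl; sym; trans; cong; cong₂; subst; module ≡-Reasoning)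
open import Algebra.Bundles using (CommutativeRing)
open import Algebra.Structures using (IsAbelianGroup)
import Algebra.Construct.Pointwise as Pointwise
open import Algebra.Solver.Ring.AlmostCommutativeRing using (fromCommutativeRing)

sumUpTo-cong : ∀ {f g : ℕ → ℤ} m → (∀ i → i ℕ.≤ m → f i ≡ g i) → sumUpTo f m ≡ sumUpTo g m
sumUpTo-cong zero    f≡g = f≡g 0 z≤n
sumUpTo-cong (suc m) f≡g =
  cong₂ _+ℤ_ (sumUpTo-cong m (λ i i≤m → f≡g i (ℕP.m≤n⇒m≤1+n i≤m))) (f≡g (suc m) ℕP.≤-refl)

sumUpTo-zero : ∀ (f : ℕ → ℤ) m → (∀ i → i ℕ.≤ m → f i ≡ + 0) → sumUpTo f m ≡ + 0
sumUpTo-zero f m f≡0 = trans (sumUpTo-cong m f≡0) (sum-0 m)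
  where
  sum-0 : ∀ m → sumUpTo (λ _ → + 0) m ≡ + 0
  sum-0 zero    = refl
  sum-0 (suc m) = trans (ℤP.+-identityʳ _) (sum-0 m)

sumUpTo-+ : ∀ (f g : ℕ → ℤ) m → sumUpTo (λ i → f i +ℤ g i) m ≡ sumUpTo f m +ℤ sumUpTo g m
sumUpTo-+ f g zero    = refl
sumUpTo-+ f g (suc m) =
  trans (cong (_+ℤ (f (suc m) +ℤ g (suc m))) (sumUpTo-+ f g m)) (interchange (sumUpTo f m) (sumUpTo g m) _ _)

sumUpTo-*ˡ : ∀ c (f : ℕ → ℤ) m → sumUpTo (λ i → c *ℤ f i) m ≡ c *ℤ sumUpTo f m
sumUpTo-*ˡ c f zero    = refl
sumUpTo-*ˡ c f (suc m) =
  trans (cong (_+ℤ c *ℤ f (suc m)) (sumUpTo-*ˡ c f m)) (sym (ℤP.*-distribˡ-+ c (sumUpTo f m) _))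

sumUpTo-*ʳ : ∀ c (f : ℕ → ℤ) m → sumUpTo (λ i → f i *ℤ c) m ≡ sumUpTo f m *ℤ c
sumUpTo-*ʳ c f m = begin
  sumUpTo (λ i → f i *ℤ c) m ≡⟨ sumUpTo-cong m (λ i _ → ℤP.*-comm (f i) c) ⟩
  sumUpTo (λ i → c *ℤ f i) m ≡⟨ sumUpTo-*ˡ c f m ⟩
  c *ℤ sumUpTo f m           ≡⟨ ℤP.*-comm c _ ⟩
  sumUpTo f m *ℤ c           ∎
  where open ≡-Reasoning

sumUpTo-suc : ∀ (f : ℕ → ℤ) m → sumUpTo f (suc m) ≡ f 0 +ℤ sumUpTo (f ∘ suc) m
sumUpTo-suc f zero    = refl
sumUpTo-suc f (suc m) = trans (cong (_+ℤ f (suc (suc m))) (sumUpTo-suc f m)) (ℤP.+-assoc (f 0) _ _)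

sumUpTo-reverse : ∀ (f : ℕ → ℤ) m → sumUpTo f m ≡ sumUpTo (λ i → f (m ∸ i)) m
sumUpTo-reverse f zero    = refl
sumUpTo-reverse f (suc m) = begin
  sumUpTo f m +ℤ f (suc m)                     ≡⟨ cong (_+ℤ f (suc m)) (sumUpTo-reverse f m) ⟩
  sumUpTo (λ i → f (m ∸ i)) m +ℤ f (suc m)     ≡⟨ ℤP.+-comm (sumUpTo (λ i → f (m ∸ i)) m) _ ⟩
  f (suc m) +ℤ sumUpTo (λ i → f (m ∸ i)) m     ≡⟨ sym (sumUpTo-suc (λ i → f (suc m ∸ i)) m) ⟩
  sumUpTo (λ i → f (suc m ∸ i)) (suc m)        ∎
  where open ≡-Reasoning

sumUpTo-triangle : ∀ (F : ℕ → ℕ → ℤ) m →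
  sumUpTo (λ i → sumUpTo (F i) i) m ≡ sumUpTo (λ j → sumUpTo (λ t → F (j + t) j) (m ∸ j)) m
sumUpTo-triangle F zero    = refl
sumUpTo-triangle F (suc m) = begin
  sumUpTo (λ i → sumUpTo (F i) i) m +ℤ sumUpTo (F (suc m)) (suc m)
    ≡⟨ cong (_+ℤ sumUpTo (F (suc m)) (suc m)) (sumUpTo-triangle F m) ⟩
  sumUpTo column m +ℤ (sumUpTo (F (suc m)) m +ℤ F (suc m) (suc m))
    ≡⟨ sym (ℤP.+-assoc (sumUpTo column m) _ _) ⟩
  (sumUpTo column m +ℤ sumUpTo (F (suc m)) m) +ℤ F (suc m) (suc m)
    ≡⟨ cong (_+ℤ F (suc m) (suc m)) (sym (sumUpTo-+ column (F (suc m)) m)) ⟩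
  sumUpTo (λ j → column j +ℤ F (suc m) j) m +ℤ F (suc m) (suc m)
    ≡⟨ cong₂ _+ℤ_ (sumUpTo-cong m extend) (cong (λ i → F i (suc m)) (sym (ℕP.+-identityʳ (suc m)))) ⟩
  sumUpTo column′ m +ℤ F (suc m + 0) (suc m)
    ≡⟨ cong (λ n → sumUpTo column′ m +ℤ sumUpTo (λ t → F (suc m + t) (suc m)) n) (sym (ℕP.n∸n≡0 m)) ⟩
  sumUpTo column′ (suc m) ∎
  where
  open ≡-Reasoning
  column column′ : ℕ → ℤ
  column  j = sumUpTo (λ t → F (j + t) j) (m ∸ j)
  column′ j = sumUpTo (λ t → F (j + t) j) (suc m ∸ j)
  extend : ∀ j → j ℕ.≤ m → column j +ℤ F (suc m) j ≡ column′ j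
  extend j j≤m = begin
    column j +ℤ F (suc m) j
      ≡⟨ cong (λ i → column j +ℤ F i j) (sym (trans (ℕP.+-suc j _) (cong suc (ℕP.m+[n∸m]≡n j≤m)))) ⟩
    sumUpTo (λ t → F (j + t) j) (suc (m ∸ j))
      ≡⟨ cong (sumUpTo (λ t → F (j + t) j)) (sym (ℕP.+-∸-assoc 1 j≤m)) ⟩
    column′ j ∎

infix 4 _≈_
_≈_ : Rel Series 0ℓ
f ≈ g = ∀ i → f i ≡ g i

infixl 6 _⊕_
_⊕_ : Series → Series → Series
(f ⊕ g) i = f i +ℤ g i

⊝_ : Series → Series
(⊝ f) i = - f i

zeroS : Series
zeroS _ = + 0

⊕-⊝-isAbelianGroup : IsAbelianGroup _≈_ _⊕_ zeroS ⊝_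
⊕-⊝-isAbelianGroup = Pointwise.isAbelianGroup ℕ ℤP.+-0-isAbelianGroup

open IsAbelianGroup ⊕-⊝-isAbelianGroup
  using () renaming (refl to ≈-refl; sym to ≈-sym; trans to ≈-trans; ∙-cong to ⊕-cong)

⊛-cong : ∀ {f f′ g g′} → f ≈ f′ → g ≈ g′ → f ⊛ g ≈ f′ ⊛ g′
⊛-cong f≈f′ g≈g′ m = sumUpTo-cong m (λ i _ → cong₂ _*ℤ_ (f≈f′ i) (g≈g′ (m ∸ i)))

⊛-comm : ∀ f g → f ⊛ g ≈ g ⊛ f
⊛-comm f g m = trans (sumUpTo-reverse _ m) (sumUpTo-cong m swap)
  where
  swap : ∀ i → i ℕ.≤ m → f (m ∸ i) *ℤ g (m ∸ (m ∸ i)) ≡ g i *ℤ f (m ∸ i)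
  swap i i≤m = trans (ℤP.*-comm (f (m ∸ i)) _) (cong (λ j → g j *ℤ f (m ∸ i)) (ℕP.m∸[m∸n]≡n i≤m))

⊛-assoc : ∀ f g h → (f ⊛ g) ⊛ h ≈ f ⊛ (g ⊛ h)
⊛-assoc f g h m = begin
  sumUpTo (λ i → (f ⊛ g) i *ℤ h (m ∸ i)) m
    ≡⟨ sumUpTo-cong m (λ i _ → sym (sumUpTo-*ʳ (h (m ∸ i)) (λ j → f j *ℤ g (i ∸ j)) i)) ⟩
  sumUpTo (λ i → sumUpTo (λ j → (f j *ℤ g (i ∸ j)) *ℤ h (m ∸ i)) i) m
    ≡⟨ sumUpTo-triangle (λ i j → (f j *ℤ g (i ∸ j)) *ℤ h (m ∸ i)) m ⟩
  sumUpTo (λ j → sumUpTo (λ t → (f j *ℤ g (j + t ∸ j)) *ℤ h (m ∸ (j + t))) (m ∸ j)) m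
    ≡⟨ sumUpTo-cong m (λ j _ → trans (sumUpTo-cong (m ∸ j) (λ t _ → regroup j t)) (sumUpTo-*ˡ (f j) _ (m ∸ j))) ⟩
  sumUpTo (λ j → f j *ℤ (g ⊛ h) (m ∸ j)) m ∎
  where
  open ≡-Reasoning
  regroup : ∀ j t → (f j *ℤ g (j + t ∸ j)) *ℤ h (m ∸ (j + t)) ≡ f j *ℤ (g t *ℤ h (m ∸ j ∸ t))
  regroup j t = trans (cong₂ (λ a b → (f j *ℤ g a) *ℤ h b) (ℕP.m+n∸m≡n j t) (sym (ℕP.∸-+-assoc m j t)))
                      (ℤP.*-assoc (f j) _ _)

⊛-identityˡ : ∀ f → oneS ⊛ f ≈ f
⊛-identityˡ f zero    = ℤP.*-identityˡ (f 0)
⊛-identityˡ f (suc m) = begin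
  (oneS ⊛ f) (suc m)
    ≡⟨ sumUpTo-suc (λ i → oneS i *ℤ f (suc m ∸ i)) m ⟩
  + 1 *ℤ f (suc m) +ℤ sumUpTo (λ i → oneS (suc i) *ℤ f (m ∸ i)) m
    ≡⟨ cong₂ _+ℤ_ (ℤP.*-identityˡ (f (suc m))) (sumUpTo-zero _ m (λ _ _ → refl)) ⟩
  f (suc m) +ℤ + 0
    ≡⟨ ℤP.+-identityʳ _ ⟩
  f (suc m) ∎
  where open ≡-Reasoning

⊛-distribʳ : ∀ h f g → (f ⊕ g) ⊛ h ≈ (f ⊛ h) ⊕ (g ⊛ h)
⊛-distribʳ h f g m =
  trans (sumUpTo-cong m (λ i _ → ℤP.*-distribʳ-+ (h (m ∸ i)) (f i) (g i))) (sumUpTo-+ _ _ m)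

ℤ[[q]] : CommutativeRing 0ℓ 0ℓ
ℤ[[q]] = record
  { _≈_ = _≈_
  ; _+_ = _⊕_
  ; _*_ = _⊛_
  ; -_ = ⊝_
  ; 0# = zeroS
  ; 1# = oneS
  ; isCommutativeRing = record
    { isRing = record
      { +-isAbelianGroup = ⊕-⊝-isAbelianGroup
      ; *-cong = ⊛-cong
      ; *-assoc = ⊛-assoc
      ; *-identity = ⊛-identityˡ , λ f → ≈-trans (⊛-comm f oneS) (⊛-identityˡ f)
      ; distrib = (λ h f g → ≈-trans (⊛-comm h (f ⊕ g)) (≈-trans (⊛-distribʳ h f g)
                                       (⊕-cong (⊛-comm f h) (⊛-comm g h))))
                , ⊛-distribʳ }
    ; *-comm = ⊛-comm } }

module ℤ[[q]] = CommutativeRing ℤ[[q]]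
module ≈-Reasoning = Relation.Binary.Reasoning.Setoid ℤ[[q]].setoid

⊝-cong : ∀ {f g} → f ≈ g → ⊝ f ≈ ⊝ g
⊝-cong f≈g i = cong -_ (f≈g i)

≡⇒≈ : ∀ {f g} → f ≡ g → f ≈ g
≡⇒≈ refl = ≈-refl

open import Algebra.Properties.Ring ℤ[[q]].ring using ([y-z]x≈yx-zx; -‿distribʳ-*)
open import Algebra.Properties.CommutativeSemigroup ℤ[[q]].*-commutativeSemigroup using (x∙yz≈y∙xz)

ind-yes : ∀ {P : Set} (p? : Dec P) → P → ind p? ≡ + 1
ind-yes (yes _) _ = refl
ind-yes (no ¬p) p = contradiction p ¬p

ind-no : ∀ {P : Set} (p? : Dec P) → ¬ P → ind p? ≡ + 0
ind-no (yes p) ¬p = contradiction p ¬p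
ind-no (no _)  _  = refl

ind-cong : ∀ {P Q : Set} (p? : Dec P) (q? : Dec Q) → (P → Q) → (Q → P) → ind p? ≡ ind q?
ind-cong (yes _) (yes _) _   _   = refl
ind-cong (yes p) (no ¬q) p→q _   = contradiction (p→q p) ¬q
ind-cong (no ¬p) (yes q) _   q→p = contradiction (q→p q) ¬p
ind-cong (no _)  (no _)  _   _   = refl

mono-≢ : ∀ {a i} → i ≢ a → mono a i ≡ + 0
mono-≢ i≢a = ind-no (_ ℕ.≟ _) i≢a

mono-< : ∀ {a i} → i ℕ.< a → mono a i ≡ + 0
mono-< i<a = mono-≢ (ℕP.<⇒≢ i<a)

sumUpTo-mono-< : ∀ a (g : ℕ → ℤ) m → m ℕ.< a → sumUpTo (λ j → mono a j *ℤ g j) m ≡ + 0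
sumUpTo-mono-< a g m m<a =
  sumUpTo-zero _ m (λ j j≤m → cong (_*ℤ g j) (mono-< (ℕP.≤-<-trans j≤m m<a)))

sumUpTo-mono-≤ : ∀ a (g : ℕ → ℤ) m → a ℕ.≤ m → sumUpTo (λ j → mono a j *ℤ g j) m ≡ g a
sumUpTo-mono-≤ a g zero z≤n = ℤP.*-identityˡ (g 0)
sumUpTo-mono-≤ a g (suc m) a≤1+m with a ℕ.≤? m
... | yes a≤m = begin
  sumUpTo (λ j → mono a j *ℤ g j) m +ℤ mono a (suc m) *ℤ g (suc m)
    ≡⟨ cong₂ (λ x y → x +ℤ y *ℤ g (suc m)) (sumUpTo-mono-≤ a g m a≤m) (mono-≢ (ℕP.>⇒≢ (s≤s a≤m))) ⟩
  g a +ℤ + 0 *ℤ g (suc m)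
    ≡⟨ ℤP.+-identityʳ (g a) ⟩
  g a ∎
  where open ≡-Reasoning
... | no a≰m with refl ← ℕP.≤-antisym a≤1+m (ℕP.≰⇒> a≰m) = begin
  sumUpTo (λ j → mono a j *ℤ g j) m +ℤ mono a a *ℤ g a
    ≡⟨ cong₂ (λ x y → x +ℤ y *ℤ g a) (sumUpTo-mono-< a g m ℕP.≤-refl) (ind-yes (a ℕ.≟ a) refl) ⟩
  + 0 +ℤ + 1 *ℤ g a
    ≡⟨ trans (ℤP.+-identityˡ _) (ℤP.*-identityˡ (g a)) ⟩
  g a ∎
  where open ≡-Reasoning

mono-⊛-< : ∀ a f i → i ℕ.< a → (mono a ⊛ f) i ≡ + 0
mono-⊛-< a f i = sumUpTo-mono-< a (λ j → f (i ∸ j)) i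

mono-⊛-+ : ∀ a f i → (mono a ⊛ f) (a + i) ≡ f i
mono-⊛-+ a f i =
  trans (sumUpTo-mono-≤ a (λ j → f (a + i ∸ j)) (a + i) (ℕP.m≤m+n a i)) (cong f (ℕP.m+n∸m≡n a i))

mono-+ : ∀ a b → mono a ⊛ mono b ≈ mono (a + b)
mono-+ a b i with a ℕ.≤? i
... | no a≰i = trans (mono-⊛-< a (mono b) i (ℕP.≰⇒> a≰i))
                     (sym (mono-< (ℕP.<-≤-trans (ℕP.≰⇒> a≰i) (ℕP.m≤m+n a b))))
... | yes a≤i with j , refl ← ℕP.m≤n⇒∃[o]m+o≡n a≤i =
  trans (mono-⊛-+ a (mono b) j)
        (ind-cong (j ℕ.≟ b) (a + j ℕ.≟ a + b) (cong (_+_ a)) (ℕP.+-cancelˡ-≡ a j b))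

-- Truncation and infinite products

infix 4 _≈[_]_
-- f ≡ g (mod q^(M+1))
_≈[_]_ : Series → ℕ → Series → Set
f ≈[ M ] g = ∀ i → i ℕ.≤ M → f i ≡ g i

≈⇒≈[] : ∀ {f g} M → f ≈ g → f ≈[ M ] g
≈⇒≈[] M f≈g i _ = f≈g i

≈[]-trans : ∀ {f g h M} → f ≈[ M ] g → g ≈[ M ] h → f ≈[ M ] h
≈[]-trans f≈g g≈h i i≤M = trans (f≈g i i≤M) (g≈h i i≤M)

⊛-cong-≈[] : ∀ {f f′ g g′ M} → f ≈[ M ] f′ → g ≈[ M ] g′ → f ⊛ g ≈[ M ] f′ ⊛ g′
⊛-cong-≈[] f≈f′ g≈g′ i i≤M = sumUpTo-cong i λ j j≤i →
  cong₂ _*ℤ_ (f≈f′ j (ℕP.≤-trans j≤i i≤M)) (g≈g′ (i ∸ j) (ℕP.≤-trans (ℕP.m∸n≤m i j) i≤M))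

⊛-≈[]-one : ∀ {f g M} → f ≈[ M ] oneS → g ≈[ M ] oneS → f ⊛ g ≈[ M ] oneS
⊛-≈[]-one {M = M} f≈1 g≈1 = ≈[]-trans (⊛-cong-≈[] f≈1 g≈1) (≈⇒≈[] M (⊛-identityˡ oneS))

infProd : (ℕ → Series) → Series
infProd fs i = finProd fs (suc i) i

-- F e ≡ 1 (mod q^e). pochInf s and invPochInf s are by definition infProd of the factors
-- oneMinus (s + 2 * j) and geom (s + 2 * j); this property makes that truncation exact.
OneBelowDegree : (ℕ → Series) → Set
OneBelowDegree F = ∀ e M → M ℕ.< e → F e ≈[ M ] oneS

finProd-stable : ∀ fs M N → (∀ j → N ℕ.≤ j → fs j ≈[ M ] oneS) →
                 ∀ t → finProd fs (t + N) ≈[ M ] finProd fs N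
finProd-stable fs M N tail≈1 zero    = λ _ _ → refl
finProd-stable fs M N tail≈1 (suc t) =
  ≈[]-trans (⊛-cong-≈[] (finProd-stable fs M N tail≈1 t) (tail≈1 (t + N) (ℕP.m≤n+m N t)))
            (≈⇒≈[] M (ℤ[[q]].*-identityʳ (finProd fs N)))

infProd-≈[]-finProd : ∀ {fs} → OneBelowDegree fs → ∀ M → infProd fs ≈[ M ] finProd fs (suc M)
infProd-≈[]-finProd {fs} fs≈1 M i i≤M =
  sym (subst (λ n → finProd fs n i ≡ finProd fs (suc i) i) (more-factors i≤M)
             (finProd-stable fs i (suc i) (λ j → fs≈1 j i) (M ∸ i) i ℕP.≤-refl))
  where
  more-factors : ∀ {i M} → i ℕ.≤ M → M ∸ i + suc i ≡ suc M
  more-factors {i} i≤M = trans (ℕP.+-suc _ i) (cong suc (ℕP.m∸n+n≡m i≤M))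

finProd-suc : ∀ fs N → fs 0 ⊛ finProd (fs ∘ suc) N ≈ finProd fs (suc N)
finProd-suc fs zero    = ⊛-comm (fs 0) oneS
finProd-suc fs (suc N) =
  ≈-trans (≈-sym (⊛-assoc (fs 0) (finProd (fs ∘ suc) N) (fs (suc N))))
          (⊛-cong (finProd-suc fs N) (≈-refl {fs (suc N)}))

infProd-suc : ∀ {fs} → OneBelowDegree fs → infProd fs ≈ fs 0 ⊛ infProd (fs ∘ suc)
infProd-suc {fs} fs≈1 i = sym (begin
  (fs 0 ⊛ infProd (fs ∘ suc)) i
    ≡⟨ ⊛-cong-≈[] {fs 0} (λ _ _ → refl) (infProd-≈[]-finProd fs∘suc≈1 i) i ℕP.≤-refl ⟩
  (fs 0 ⊛ finProd (fs ∘ suc) (suc i)) i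
    ≡⟨ finProd-suc fs (suc i) i ⟩
  finProd fs (2 + i) i
    ≡⟨ finProd-stable fs i (suc i) (λ j → fs≈1 j i) 1 i ℕP.≤-refl ⟩
  finProd fs (suc i) i ∎)
  where
  open ≡-Reasoning
  fs∘suc≈1 : OneBelowDegree (fs ∘ suc)
  fs∘suc≈1 j M M<j = fs≈1 (suc j) M (ℕP.m<n⇒m<1+n M<j)

infProd-≈[]-one : ∀ fs M → (∀ j → fs j ≈[ M ] oneS) → infProd fs ≈[ M ] oneS
infProd-≈[]-one fs M fs≈1 i i≤M = finProd≈1 (suc i) i i≤M
  where
  finProd≈1 : ∀ N → finProd fs N ≈[ M ] oneS
  finProd≈1 zero    = λ _ _ → refl
  finProd≈1 (suc N) = ⊛-≈[]-one (finProd≈1 N) (fs≈1 N)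

finProd-cong : ∀ {fs gs} → (∀ j → fs j ≈ gs j) → ∀ N → finProd fs N ≈ finProd gs N
finProd-cong fs≈gs zero    = ≈-refl
finProd-cong fs≈gs (suc N) = ⊛-cong (finProd-cong fs≈gs N) (fs≈gs N)

infProd-step2-suc : ∀ {F} → OneBelowDegree F → ∀ s →
  infProd (λ j → F (s + 2 * j)) ≈ F s ⊛ infProd (λ j → F (s + 2 + 2 * j))
infProd-step2-suc {F} F≈1 s = ≈-trans (infProd-suc F∘step≈1)
  (⊛-cong (λ i → cong (λ e → F e i) (ℕP.+-identityʳ s))
          (λ i → finProd-cong (λ j i → cong (λ e → F e i) (reindex j)) (suc i) i))
  where
  F∘step≈1 : OneBelowDegree (λ j → F (s + 2 * j))
  F∘step≈1 j M M<j = F≈1 (s + 2 * j) M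
    (ℕP.<-≤-trans M<j (ℕP.≤-trans (ℕP.m≤m+n j (j + 0)) (ℕP.m≤n+m (2 * j) s)))
  reindex : ∀ j → s + 2 * suc j ≡ s + 2 + 2 * j
  reindex j = trans (cong (λ n → s + n) (ℕP.*-suc 2 j)) (sym (ℕP.+-assoc s 2 (2 * j)))

oneMinus-oneBelow : OneBelowDegree oneMinus
oneMinus-oneBelow e M M<e i i≤M =
  trans (cong (λ x → oneS i ℤ.- x) (mono-< (ℕP.≤-<-trans i≤M M<e))) (ℤP.+-identityʳ (oneS i))

geom-oneBelow : OneBelowDegree geom
geom-oneBelow e M M<e zero    _   = ind-yes (e ∣? 0) (e ∣0)
geom-oneBelow e M M<e (suc i) i≤M = ind-no (e ∣? suc i) λ e∣1+i →
  ℕP.<⇒≱ (ℕP.≤-<-trans i≤M M<e) (∣⇒≤ e∣1+i)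

geom-periodic : ∀ e j → geom e (e + j) ≡ geom e j
geom-periodic e j = ind-cong (e ∣? e + j) (e ∣? j) (λ e∣e+j → ∣m+n∣m⇒∣n e∣e+j ∣-refl) (∣m∣n⇒∣m+n ∣-refl)

oneMinus-⊛ : ∀ e f → oneMinus e ⊛ f ≈ f ⊕ ⊝ (mono e ⊛ f)
oneMinus-⊛ e f = ≈-trans ([y-z]x≈yx-zx f oneS (mono e)) (⊕-cong (⊛-identityˡ f) (≈-refl {⊝ (mono e ⊛ f)}))

oneMinus-⊛-geom : ∀ e .{{_ : NonZero e}} → oneMinus e ⊛ geom e ≈ oneS
oneMinus-⊛-geom e i with e ℕ.≤? i
... | yes e≤i with j , refl ← ℕP.m≤n⇒∃[o]m+o≡n e≤i = begin
  (oneMinus e ⊛ geom e) (e + j)                    ≡⟨ oneMinus-⊛ e (geom e) (e + j) ⟩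
  geom e (e + j) ℤ.- (mono e ⊛ geom e) (e + j)    ≡⟨ cong₂ ℤ._-_ (geom-periodic e j) (mono-⊛-+ e (geom e) j) ⟩
  geom e j ℤ.- geom e j                            ≡⟨ ℤP.+-inverseʳ (geom e j) ⟩
  + 0                                              ≡⟨ sym (mono-≢ (ℕ.≢-nonZero⁻¹ e ∘ ℕP.m+n≡0⇒m≡0 e)) ⟩
  oneS (e + j) ∎
  where open ≡-Reasoning
... | no e≰i = begin
  (oneMinus e ⊛ geom e) i                ≡⟨ oneMinus-⊛ e (geom e) i ⟩
  geom e i ℤ.- (mono e ⊛ geom e) i      ≡⟨ cong (λ x → geom e i ℤ.- x) (mono-⊛-< e (geom e) i (ℕP.≰⇒> e≰i)) ⟩
  geom e i ℤ.- + 0                       ≡⟨ ℤP.+-identityʳ (geom e i) ⟩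
  geom e i                               ≡⟨ geom-oneBelow e i (ℕP.≰⇒> e≰i) i ℕP.≤-refl ⟩
  oneS i ∎
  where open ≡-Reasoning

oneMinus-⊛-⊛-geom : ∀ e .{{_ : NonZero e}} f → oneMinus e ⊛ (f ⊛ geom e) ≈ f
oneMinus-⊛-⊛-geom e f = ≈-trans (x∙yz≈y∙xz (oneMinus e) f (geom e))
  (≈-trans (⊛-cong (≈-refl {f}) (oneMinus-⊛-geom e)) (ℤ[[q]].*-identityʳ f))

infProd-step2-≈[]-one : ∀ {F} → OneBelowDegree F → ∀ {s M} → M ℕ.< s → infProd (λ j → F (s + 2 * j)) ≈[ M ] oneS
infProd-step2-≈[]-one F≈1 {s} {M} M<s =
  infProd-≈[]-one _ M (λ j → F≈1 (s + 2 * j) M (ℕP.<-≤-trans M<s (ℕP.m≤m+n s (2 * j))))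

pochInf-suc : ∀ s → pochInf s ≈ oneMinus s ⊛ pochInf (s + 2)
pochInf-suc = infProd-step2-suc oneMinus-oneBelow

invPochInf-suc : ∀ s → invPochInf s ≈ geom s ⊛ invPochInf (s + 2)
invPochInf-suc = infProd-step2-suc geom-oneBelow


-- Polynomials in q and X as power series

ℤ[[q]]ₐ : AlmostCommutativeRing 0ℓ 0ℓ
ℤ[[q]]ₐ = fromCommutativeRing ℤ[[q]]

fromℤ : ℤ → Series
fromℤ a i = a *ℤ oneS i

fromℤ-⊛ : ∀ a f → fromℤ a ⊛ f ≈ (λ i → a *ℤ f i)
fromℤ-⊛ a f m = begin
  sumUpTo (λ i → (a *ℤ oneS i) *ℤ f (m ∸ i)) m   ≡⟨ sumUpTo-cong m (λ i _ → ℤP.*-assoc a (oneS i) _) ⟩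
  sumUpTo (λ i → a *ℤ (oneS i *ℤ f (m ∸ i))) m   ≡⟨ sumUpTo-*ˡ a _ m ⟩
  a *ℤ (oneS ⊛ f) m                               ≡⟨ cong (a *ℤ_) (⊛-identityˡ f m) ⟩
  a *ℤ f m                                        ∎
  where open ≡-Reasoning

fromℤ-hom : ℤ.+-*-rawRing -Raw-AlmostCommutative⟶ ℤ[[q]]ₐ
fromℤ-hom = record
  { ⟦_⟧ = fromℤ
  ; +-homo = λ a b i → ℤP.*-distribʳ-+ (oneS i) a b
  ; *-homo = λ a b i → trans (ℤP.*-assoc a b (oneS i)) (sym (fromℤ-⊛ a (fromℤ b) i))
  ; -‿homo = λ a i → sym (ℤP.neg-distribˡ-* a (oneS i))
  ; 0-homo = λ _ → refl
  ; 1-homo = λ i → ℤP.*-identityˡ (oneS i) }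

fromℤ-≟ : ∀ a b → Maybe (fromℤ a ≈ fromℤ b)
fromℤ-≟ a b with a ℤ.≟ b
... | yes refl = just ≈-refl
... | no _     = nothing

open import Algebra.Solver.Ring ℤ.+-*-rawRing ℤ[[q]]ₐ fromℤ-hom fromℤ-≟
  using (solve; _:=_; _:+_; _:*_; :-_)

module ℤ[q] = Polynomial ℤ.+-*-rawRing
module ℤ[q][X] = Polynomial ℤ[q].polyRawRing

qS : Series
qS = mono 1

⟦_⟧ : ℤ[q].Poly → Series
⟦_⟧ = Horner.eval fromℤ-hom qS

⟦⟧-hom : ℤ[q].polyRawRing -Raw-AlmostCommutative⟶ ℤ[[q]]ₐ
⟦⟧-hom = Horner.eval-hom fromℤ-hom qS

⟦_⟧⟨_⟩ : ℤ[q][X].Poly → Series → Series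
⟦ P ⟧⟨ x ⟩ = Horner.eval ⟦⟧-hom x P

module ⟦⟧ = _-Raw-AlmostCommutative⟶_ ⟦⟧-hom
module ⟦⟧⟨⟩ x = _-Raw-AlmostCommutative⟶_ (Horner.eval-hom ⟦⟧-hom x)

⟦X^⟧ : ∀ n → ⟦ ℤ[q].X^ n ⟧ ≈ mono n
⟦X^⟧ zero    = ≈-trans (Horner.eval-const fromℤ-hom qS (+ 1)) (λ i → ℤP.*-identityˡ (oneS i))
⟦X^⟧ (suc n) = ≈-trans (⊕-cong (≈-refl {zeroS}) (⊛-cong (≈-refl {qS}) (⟦X^⟧ n)))
                       (≈-trans (ℤ[[q]].+-identityˡ _) (mono-+ 1 n))

coeff : ℤ[q].Poly → Series
coeff []      _       = + 0
coeff (a ∷ p) zero    = a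
coeff (a ∷ p) (suc i) = coeff p i

⟦⟧-coeff : ∀ p → ⟦ p ⟧ ≈ coeff p
⟦⟧-coeff []      i       = refl
⟦⟧-coeff (a ∷ p) zero    =
  trans (cong (a *ℤ + 1 +ℤ_) (mono-⊛-< 1 ⟦ p ⟧ 0 (s≤s z≤n))) (trans (ℤP.+-identityʳ _) (ℤP.*-identityʳ a))
⟦⟧-coeff (a ∷ p) (suc i) =
  trans (cong₂ _+ℤ_ (ℤP.*-zeroʳ a) (mono-⊛-+ 1 ⟦ p ⟧ i)) (trans (ℤP.+-identityˡ _) (⟦⟧-coeff p i))


open ℤ[q][X] using (_+ₚ_; _*ₚ_; -ₚ_; dilate; sumCoeffs)

1-q^_X : ℕ → ℤ[q][X].Poly
1-q^ a X = ℤ[q].X^ 0 ∷ ℤ[q].-ₚ ℤ[q].X^ a ∷ []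

qX : ℤ[q][X].Poly
qX = [] ∷ ℤ[q].X^ 1 ∷ []

⟦∷∷[]⟧ : ∀ a b x → ⟦ a ∷ b ∷ [] ⟧⟨ x ⟩ ≈ ⟦ a ⟧ ⊕ x ⊛ ⟦ b ⟧
⟦∷∷[]⟧ a b x = ⊕-cong (≈-refl {⟦ a ⟧}) (⊛-cong (≈-refl {x}) (Horner.eval-const ⟦⟧-hom x b))

⟦1-q^X⟧ : ∀ a b → ⟦ 1-q^ a X ⟧⟨ mono b ⟩ ≈ oneMinus (b + a)
⟦1-q^X⟧ a b = begin
  ⟦ 1-q^ a X ⟧⟨ mono b ⟩                              ≈⟨ ⟦∷∷[]⟧ (ℤ[q].X^ 0) (ℤ[q].-ₚ ℤ[q].X^ a) (mono b) ⟩
  ⟦ ℤ[q].X^ 0 ⟧ ⊕ mono b ⊛ ⟦ ℤ[q].-ₚ ℤ[q].X^ a ⟧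
    ≈⟨ ⊕-cong (⟦X^⟧ 0) (⊛-cong (≈-refl {mono b}) (≈-trans (⟦⟧.-‿homo (ℤ[q].X^ a)) (⊝-cong (⟦X^⟧ a)))) ⟩
  oneS ⊕ mono b ⊛ ⊝ mono a
    ≈⟨ ⊕-cong (≈-refl {oneS}) (≈-sym (-‿distribʳ-* (mono b) (mono a))) ⟩
  oneS ⊕ ⊝ (mono b ⊛ mono a)
    ≈⟨ ⊕-cong (≈-refl {oneS}) (⊝-cong (mono-+ b a)) ⟩
  oneMinus (b + a) ∎
  where open ≈-Reasoning

⟦qX⟧ : ∀ b → ⟦ qX ⟧⟨ mono b ⟩ ≈ mono (b + 1)
⟦qX⟧ b = begin
  ⟦ qX ⟧⟨ mono b ⟩                     ≈⟨ ⟦∷∷[]⟧ [] (ℤ[q].X^ 1) (mono b) ⟩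
  zeroS ⊕ mono b ⊛ ⟦ ℤ[q].X^ 1 ⟧       ≈⟨ ℤ[[q]].+-identityˡ _ ⟩
  mono b ⊛ ⟦ ℤ[q].X^ 1 ⟧               ≈⟨ ⊛-cong (≈-refl {mono b}) (⟦X^⟧ 1) ⟩
  mono b ⊛ mono 1                      ≈⟨ mono-+ b 1 ⟩
  mono (b + 1)                         ∎
  where open ≈-Reasoning

⟦dilate-q²⟧ : ∀ P b → ⟦ dilate (ℤ[q].X^ 2) P ⟧⟨ mono b ⟩ ≈ ⟦ P ⟧⟨ mono (2 + b) ⟩
⟦dilate-q²⟧ P b = ≈-trans (Horner.eval-dilate ⟦⟧-hom (ℤ[q].X^ 2) (mono b) P)
  (Horner.eval-cong ⟦⟧-hom (≈-trans (⊛-cong (⟦X^⟧ 2) (≈-refl {mono b})) (mono-+ 2 b)) P)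

⟦∷⟧⟨⟩-≈[] : ∀ {x M} a P → x ≈[ M ] zeroS → ⟦ a ∷ P ⟧⟨ x ⟩ ≈[ M ] ⟦ a ⟧
⟦∷⟧⟨⟩-≈[] {x} a P x≈0 i i≤M = begin
  ⟦ a ⟧ i +ℤ (x ⊛ ⟦ P ⟧⟨ x ⟩) i       ≡⟨ cong (⟦ a ⟧ i +ℤ_) (⊛-cong-≈[] {g = ⟦ P ⟧⟨ x ⟩} x≈0 (λ _ _ → refl) i i≤M) ⟩
  ⟦ a ⟧ i +ℤ (zeroS ⊛ ⟦ P ⟧⟨ x ⟩) i   ≡⟨ cong (⟦ a ⟧ i +ℤ_) (ℤ[[q]].zeroˡ ⟦ P ⟧⟨ x ⟩ i) ⟩
  ⟦ a ⟧ i +ℤ + 0                      ≡⟨ ℤP.+-identityʳ _ ⟩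
  ⟦ a ⟧ i                             ∎
  where open ≡-Reasoning

A[X] : ℤ[q][X].Poly
A[X] = 1-q^ 1 X *ₚ 1-q^ 1 X

B[X] : ℕ → ℤ[q][X].Poly
B[X] k = 1-q^ 2 X *ₚ 1-q^ (2 * k) X

-- X stands for q^(2n); the vanishing of this polynomial is gosper-step below.
gosperDefect : ℕ → ℤ[q][X].Poly → ℤ[q].Poly → ℤ[q][X].Poly
gosperDefect k σ d = σ *ₚ B[X] k +ₚ -ₚ (dilate (ℤ[q].X^ 2) σ *ₚ A[X] +ₚ (d ∷ []) *ₚ (qX *ₚ B[X] k))

-- Telescoping

module Telescoping (k : ℕ) where

  -- Fterm k n unfolds to P n ⊛ mono (2 * n + 1).
  A B G P : ℕ → Series
  A n = oneMinus (2 * n + 1) ⊛ oneMinus (2 * n + 1)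
  B n = oneMinus (2 * n + 2) ⊛ oneMinus (2 * n + 2 * k)
  G n = geom (2 * n + 1) ⊛ geom (2 * n + 1)
  P n = pochInf (2 * n + 2) ⊛ pochInf (2 * n + 2 * k) ⊛ invPochInf (2 * n + 1) ⊛ invPochInf (2 * n + 1)

  G⊛A≈1 : ∀ n → G n ⊛ A n ≈ oneS
  G⊛A≈1 n = begin
    G n ⊛ A n
      ≈⟨ solve 2 (λ g o → (g :* g) :* (o :* o) := (o :* g) :* (o :* g))
               ≈-refl (geom (2 * n + 1)) (oneMinus (2 * n + 1)) ⟩
    (oneMinus (2 * n + 1) ⊛ geom (2 * n + 1)) ⊛ (oneMinus (2 * n + 1) ⊛ geom (2 * n + 1))
      ≈⟨ ⊛-cong o⊛g≈1 o⊛g≈1 ⟩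
    oneS ⊛ oneS
      ≈⟨ ⊛-identityˡ oneS ⟩
    oneS ∎
    where
    open ≈-Reasoning
    o⊛g≈1 : oneMinus (2 * n + 1) ⊛ geom (2 * n + 1) ≈ oneS
    o⊛g≈1 = oneMinus-⊛-geom (2 * n + 1) {{ℕ.≢-nonZero (ℕP.m+1+n≢0 (2 * n))}}

  P-suc : ∀ n → P n ≈ G n ⊛ B n ⊛ P (suc n)
  P-suc n = begin
    P n
      ≈⟨ ⊛-cong (⊛-cong (⊛-cong (pochInf-suc s₂) (pochInf-suc sₖ)) (invPochInf-suc s₁)) (invPochInf-suc s₁) ⟩
    oneMinus s₂ ⊛ pochInf (s₂ + 2) ⊛ (oneMinus sₖ ⊛ pochInf (sₖ + 2))
      ⊛ (geom s₁ ⊛ invPochInf (s₁ + 2)) ⊛ (geom s₁ ⊛ invPochInf (s₁ + 2))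
      ≈⟨ solve 7 (λ o₂ p₂ oₖ pₖ g p₁ p₁′ → o₂ :* p₂ :* (oₖ :* pₖ) :* (g :* p₁) :* (g :* p₁′)
                                          := (g :* g) :* (o₂ :* oₖ) :* (p₂ :* pₖ :* p₁ :* p₁′))
               ≈-refl (oneMinus s₂) (pochInf (s₂ + 2)) (oneMinus sₖ) (pochInf (sₖ + 2))
                      (geom s₁) (invPochInf (s₁ + 2)) (invPochInf (s₁ + 2)) ⟩
    G n ⊛ B n ⊛ (pochInf (s₂ + 2) ⊛ pochInf (sₖ + 2) ⊛ invPochInf (s₁ + 2) ⊛ invPochInf (s₁ + 2))
      ≈⟨ ⊛-cong (≈-refl {G n ⊛ B n}) (≡⇒≈ reindexed) ⟩
    G n ⊛ B n ⊛ P (suc n) ∎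
    where
    open ≈-Reasoning
    s₁ s₂ sₖ : ℕ
    s₁ = 2 * n + 1
    s₂ = 2 * n + 2
    sₖ = 2 * n + 2 * k
    shift : ∀ j → 2 * n + j + 2 ≡ 2 * suc n + j
    shift j = trans (ℕP.+-comm (2 * n + j) 2)
                    (trans (sym (ℕP.+-assoc 2 (2 * n) j)) (cong (_+ j) (sym (ℕP.*-suc 2 n))))
    reindexed : pochInf (s₂ + 2) ⊛ pochInf (sₖ + 2) ⊛ invPochInf (s₁ + 2) ⊛ invPochInf (s₁ + 2) ≡ P (suc n)
    reindexed rewrite shift 2 | shift (2 * k) | shift 1 = refl

  ⟦A[X]⟧ : ∀ n → ⟦ A[X] ⟧⟨ mono (2 * n) ⟩ ≈ A n
  ⟦A[X]⟧ n = ≈-trans (⟦⟧⟨⟩.*-homo (mono (2 * n)) (1-q^ 1 X) (1-q^ 1 X))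
                     (⊛-cong (⟦1-q^X⟧ 1 (2 * n)) (⟦1-q^X⟧ 1 (2 * n)))

  ⟦B[X]⟧ : ∀ n → ⟦ B[X] k ⟧⟨ mono (2 * n) ⟩ ≈ B n
  ⟦B[X]⟧ n = ≈-trans (⟦⟧⟨⟩.*-homo (mono (2 * n)) (1-q^ 2 X) (1-q^ (2 * k) X))
                     (⊛-cong (⟦1-q^X⟧ 2 (2 * n)) (⟦1-q^X⟧ (2 * k) (2 * n)))

  P-≈[]-one : ∀ {n m} → m ℕ.< 2 * n → P n ≈[ m ] oneS
  P-≈[]-one {n} m<2n =
    ⊛-≈[]-one (⊛-≈[]-one (⊛-≈[]-one (infProd-step2-≈[]-one oneMinus-oneBelow (m<2n+ 2))
                                    (infProd-step2-≈[]-one oneMinus-oneBelow (m<2n+ (2 * k))))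
                         (infProd-step2-≈[]-one geom-oneBelow (m<2n+ 1)))
              (infProd-step2-≈[]-one geom-oneBelow (m<2n+ 1))
    where
    m<2n+_ : ∀ j → _ ℕ.< 2 * n + j
    m<2n+ j = ℕP.<-≤-trans m<2n (ℕP.m≤m+n (2 * n) j)

  module _ (σ₀ : ℤ[q].Poly) (σ₊ : ℤ[q][X].Poly) (d : ℤ[q].Poly) where

    σ : ℤ[q][X].Poly
    σ = σ₀ ∷ σ₊

    S V : ℕ → Series
    S n = ⟦ σ ⟧⟨ mono (2 * n) ⟩
    V n = S n ⊛ P n

    ⟦gosperDefect⟧ : ∀ n → ⟦ gosperDefect k σ d ⟧⟨ mono (2 * n) ⟩
                         ≈ S n ⊛ B n ⊕ ⊝ (S (suc n) ⊛ A n ⊕ ⟦ d ⟧ ⊛ (mono (2 * n + 1) ⊛ B n))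
    ⟦gosperDefect⟧ n = begin
      ⟦ σ *ₚ B[X] k +ₚ -ₚ (σ′ *ₚ A[X] +ₚ (d ∷ []) *ₚ (qX *ₚ B[X] k)) ⟧⟨ x ⟩
        ≈⟨ ≈-trans (E.+-homo (σ *ₚ B[X] k) (-ₚ (σ′ *ₚ A[X] +ₚ dqXB))) (⊕-cong (≈-refl {⟦ σ *ₚ B[X] k ⟧⟨ x ⟩})
             (≈-trans (E.-‿homo (σ′ *ₚ A[X] +ₚ dqXB)) (⊝-cong (E.+-homo (σ′ *ₚ A[X]) dqXB)))) ⟩
      ⟦ σ *ₚ B[X] k ⟧⟨ x ⟩ ⊕ ⊝ (⟦ σ′ *ₚ A[X] ⟧⟨ x ⟩ ⊕ ⟦ (d ∷ []) *ₚ (qX *ₚ B[X] k) ⟧⟨ x ⟩)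
        ≈⟨ ⊕-cong (E.*-homo σ (B[X] k)) (⊝-cong (⊕-cong (E.*-homo σ′ A[X])
             (≈-trans (E.*-homo (d ∷ []) (qX *ₚ B[X] k))
                      (⊛-cong (≈-refl {⟦ d ∷ [] ⟧⟨ x ⟩}) (E.*-homo qX (B[X] k)))))) ⟩
      S n ⊛ ⟦ B[X] k ⟧⟨ x ⟩
        ⊕ ⊝ (⟦ σ′ ⟧⟨ x ⟩ ⊛ ⟦ A[X] ⟧⟨ x ⟩ ⊕ ⟦ d ∷ [] ⟧⟨ x ⟩ ⊛ (⟦ qX ⟧⟨ x ⟩ ⊛ ⟦ B[X] k ⟧⟨ x ⟩))
        ≈⟨ ⊕-cong (⊛-cong (≈-refl {S n}) (⟦B[X]⟧ n))
                  (⊝-cong (⊕-cong (⊛-cong ⟦σ′⟧ (⟦A[X]⟧ n))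
                                  (⊛-cong (Horner.eval-const ⟦⟧-hom x d) (⊛-cong (⟦qX⟧ (2 * n)) (⟦B[X]⟧ n))))) ⟩
      S n ⊛ B n ⊕ ⊝ (S (suc n) ⊛ A n ⊕ ⟦ d ⟧ ⊛ (mono (2 * n + 1) ⊛ B n)) ∎
      where
      open ≈-Reasoning
      module E = ⟦⟧⟨⟩ (mono (2 * n))
      x : Series
      x = mono (2 * n)
      σ′ dqXB : ℤ[q][X].Poly
      σ′ = dilate (ℤ[q].X^ 2) σ
      dqXB = (d ∷ []) *ₚ (qX *ₚ B[X] k)
      ⟦σ′⟧ : ⟦ σ′ ⟧⟨ x ⟩ ≈ S (suc n)
      ⟦σ′⟧ = ≈-trans (⟦dilate-q²⟧ σ (2 * n)) (≡⇒≈ (cong (λ e → ⟦ σ ⟧⟨ mono e ⟩) (sym (ℕP.*-suc 2 n))))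

    module _ (gosper : All (All (_≡ + 0)) (gosperDefect k σ d)) where

      gosper-step : ∀ n → S n ⊛ B n ≈ S (suc n) ⊛ A n ⊕ ⟦ d ⟧ ⊛ (mono (2 * n + 1) ⊛ B n)
      gosper-step n i = ℤP.i-j≡0⇒i≡j _ _ (trans (sym (⟦gosperDefect⟧ n i)) (defect≈0 i))
        where
        defect≈0 : ⟦ gosperDefect k σ d ⟧⟨ mono (2 * n) ⟩ ≈ zeroS
        defect≈0 = Horner.eval-vanishes ⟦⟧-hom (mono (2 * n))
                     (Horner.eval-vanishes fromℤ-hom qS λ { refl _ → refl }) gosper

      telescope : ∀ n → ⟦ d ⟧ ⊛ Fterm k n ≈ V n ⊕ ⊝ V (suc n)
      telescope n = ≈-sym (begin
        V n ⊕ ⊝ V (suc n)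
          ≈⟨ ⊕-cong (⊛-cong (≈-refl {S n}) (P-suc n)) (≈-refl {⊝ V (suc n)}) ⟩
        S n ⊛ (G n ⊛ B n ⊛ P′) ⊕ ⊝ (S′ ⊛ P′)
          ≈⟨ solve 5 (λ s g b p s′ → s :* (g :* b :* p) :+ :- (s′ :* p) := g :* p :* (s :* b) :+ :- (s′ :* p))
                   ≈-refl (S n) (G n) (B n) P′ S′ ⟩
        G n ⊛ P′ ⊛ (S n ⊛ B n) ⊕ ⊝ (S′ ⊛ P′)
          ≈⟨ ⊕-cong (⊛-cong (≈-refl {G n ⊛ P′}) (gosper-step n)) (≈-refl {⊝ (S′ ⊛ P′)}) ⟩
        G n ⊛ P′ ⊛ (S′ ⊛ A n ⊕ ⟦ d ⟧ ⊛ (Q ⊛ B n)) ⊕ ⊝ (S′ ⊛ P′)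
          ≈⟨ solve 7 (λ g p s′ a d q b → g :* p :* (s′ :* a :+ d :* (q :* b)) :+ :- (s′ :* p)
                                        := (g :* a) :* (s′ :* p) :+ :- (s′ :* p) :+ d :* (g :* b :* p :* q))
                   ≈-refl (G n) P′ S′ (A n) ⟦ d ⟧ Q (B n) ⟩
        (G n ⊛ A n) ⊛ (S′ ⊛ P′) ⊕ ⊝ (S′ ⊛ P′) ⊕ ⟦ d ⟧ ⊛ (G n ⊛ B n ⊛ P′ ⊛ Q)
          ≈⟨ ⊕-cong (⊕-cong (≈-trans (⊛-cong (G⊛A≈1 n) (≈-refl {S′ ⊛ P′})) (⊛-identityˡ (S′ ⊛ P′)))
                            (≈-refl {⊝ (S′ ⊛ P′)}))
                    (⊛-cong (≈-refl {⟦ d ⟧}) (⊛-cong (≈-sym (P-suc n)) (≈-refl {Q}))) ⟩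
        S′ ⊛ P′ ⊕ ⊝ (S′ ⊛ P′) ⊕ ⟦ d ⟧ ⊛ Fterm k n
          ≈⟨ solve 2 (λ v f → v :+ :- v :+ f := f) ≈-refl (S′ ⊛ P′) (⟦ d ⟧ ⊛ Fterm k n) ⟩
        ⟦ d ⟧ ⊛ Fterm k n ∎)
        where
        open ≈-Reasoning
        S′ P′ Q : Series
        S′ = S (suc n)
        P′ = P (suc n)
        Q  = mono (2 * n + 1)

      partialSum : ℕ → Series
      partialSum N i = sumUpTo (λ n → Fterm k n i) N

      partialSum-telescopes : ∀ N → ⟦ d ⟧ ⊛ partialSum N ≈ V 0 ⊕ ⊝ V (suc N)
      partialSum-telescopes zero    = telescope 0
      partialSum-telescopes (suc N) = begin
        ⟦ d ⟧ ⊛ (partialSum N ⊕ Fterm k (suc N))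
          ≈⟨ ℤ[[q]].distribˡ ⟦ d ⟧ (partialSum N) (Fterm k (suc N)) ⟩
        ⟦ d ⟧ ⊛ partialSum N ⊕ ⟦ d ⟧ ⊛ Fterm k (suc N)
          ≈⟨ ⊕-cong (partialSum-telescopes N) (telescope (suc N)) ⟩
        V 0 ⊕ ⊝ V (suc N) ⊕ (V (suc N) ⊕ ⊝ V (2 + N))
          ≈⟨ solve 3 (λ a b c → a :+ :- b :+ (b :+ :- c) := a :+ :- c) ≈-refl (V 0) (V (suc N)) (V (2 + N)) ⟩
        V 0 ⊕ ⊝ V (2 + N) ∎
        where open ≈-Reasoning

      module _ (σ-at-1 : All (_≡ + 0) (sumCoeffs σ)) where

        V0≈0 : V 0 ≈ zeroS
        V0≈0 = ≈-trans (⊛-cong {g = P 0} {g′ = P 0} S0≈0 (≈-refl {P 0})) (ℤ[[q]].zeroˡ (P 0))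
          where
          S0≈0 : ⟦ σ ⟧⟨ oneS ⟩ ≈ zeroS
          S0≈0 = ≈-trans (Horner.eval-one ⟦⟧-hom σ)
                         (Horner.eval-vanishes fromℤ-hom qS (λ { refl _ → refl }) σ-at-1)

        V-≈[]-σ₀ : ∀ {N m} → m ℕ.≤ N → V (suc N) ≈[ m ] ⟦ σ₀ ⟧
        V-≈[]-σ₀ {N} {m} m≤N =
          ≈[]-trans (⊛-cong-≈[] {S (suc N)} {⟦ σ₀ ⟧} {P (suc N)} {oneS} {m}
                                (⟦∷⟧⟨⟩-≈[] σ₀ σ₊ X≈0) (P-≈[]-one {suc N} m<2+2N))
                    (≈⇒≈[] m (ℤ[[q]].*-identityʳ ⟦ σ₀ ⟧))
          where
          m<2+2N : m ℕ.< 2 * suc N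
          m<2+2N = ℕP.<-≤-trans (s≤s m≤N) (ℕP.m≤m+n (suc N) (suc N + 0))
          X≈0 : mono (2 * suc N) ≈[ m ] zeroS
          X≈0 i i≤m = mono-< (ℕP.≤-<-trans i≤m m<2+2N)

        c-closed-form : ∀ {h} → h ⊛ ⟦ d ⟧ ≈ oneS → ∀ m → c k m ≡ (h ⊛ ⊝ ⟦ σ₀ ⟧) m
        c-closed-form {h} h⊛d≈1 m = begin
          partialSum m m
            ≡⟨ sym (⊛-identityˡ (partialSum m) m) ⟩
          (oneS ⊛ partialSum m) m
            ≡⟨ ⊛-cong (≈-sym h⊛d≈1) (≈-refl {partialSum m}) m ⟩
          ((h ⊛ ⟦ d ⟧) ⊛ partialSum m) m
            ≡⟨ ⊛-assoc h ⟦ d ⟧ (partialSum m) m ⟩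
          (h ⊛ (⟦ d ⟧ ⊛ partialSum m)) m
            ≡⟨ ⊛-cong (≈-refl {h}) (partialSum-telescopes m) m ⟩
          (h ⊛ (V 0 ⊕ ⊝ V (suc m))) m
            ≡⟨ ⊛-cong-≈[] {h} {h} {V 0 ⊕ ⊝ V (suc m)} {zeroS ⊕ ⊝ ⟦ σ₀ ⟧} {m} (λ _ _ → refl) tail m ℕP.≤-refl ⟩
          (h ⊛ (zeroS ⊕ ⊝ ⟦ σ₀ ⟧)) m
            ≡⟨ ⊛-cong (≈-refl {h}) (ℤ[[q]].+-identityˡ (⊝ ⟦ σ₀ ⟧)) m ⟩
          (h ⊛ ⊝ ⟦ σ₀ ⟧) m ∎
          where
          open ≡-Reasoning
          tail : V 0 ⊕ ⊝ V (suc m) ≈[ m ] zeroS ⊕ ⊝ ⟦ σ₀ ⟧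
          tail i i≤m = cong₂ _+ℤ_ (V0≈0 i) (cong -_ (V-≈[]-σ₀ ℕP.≤-refl i i≤m))

-- Nonnegativity

NonNeg : Series → Set
NonNeg f = ∀ i → + 0 ≤ f i

0≤i⇒0≤j⇒0≤i*j : ∀ {a b} → + 0 ≤ a → + 0 ≤ b → + 0 ≤ a *ℤ b
0≤i⇒0≤j⇒0≤i*j {+ m} {+ n} _ _ = subst (+ 0 ≤_) (ℤP.pos-* m n) (+≤+ z≤n)

sumUpTo-nonNeg : ∀ (f : ℕ → ℤ) m → (∀ i → + 0 ≤ f i) → + 0 ≤ sumUpTo f m
sumUpTo-nonNeg f zero    0≤f = 0≤f 0
sumUpTo-nonNeg f (suc m) 0≤f = ℤP.+-mono-≤ (sumUpTo-nonNeg f m 0≤f) (0≤f (suc m))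

⊛-nonNeg : ∀ {f g} → NonNeg f → NonNeg g → NonNeg (f ⊛ g)
⊛-nonNeg 0≤f 0≤g m = sumUpTo-nonNeg _ m (λ i → 0≤i⇒0≤j⇒0≤i*j (0≤f i) (0≤g (m ∸ i)))

ind-nonNeg : ∀ {P : Set} (p? : Dec P) → + 0 ≤ ind p?
ind-nonNeg (yes _) = +≤+ z≤n
ind-nonNeg (no _)  = +≤+ z≤n

geoms : List ℕ → Series
geoms = foldr (λ e f → geom e ⊛ f) oneS

geoms-nonNeg : ∀ es → NonNeg (geoms es)
geoms-nonNeg []       i = ind-nonNeg (i ℕ.≟ 0)
geoms-nonNeg (e ∷ es)   = ⊛-nonNeg (λ i → ind-nonNeg (e ∣? i)) (geoms-nonNeg es)

nonNeg-from-window : ∀ (f : Series) e .{{_ : NonZero e}} L → (∀ i → L ℕ.≤ i → f (e + i) ≡ f i) →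
                     (∀ i → i ℕ.< L + e → + 0 ≤ f i) → NonNeg f
nonNeg-from-window f e L periodic window = <-rec (λ i → + 0 ≤ f i) step
  where
  step : ∀ i → (∀ {j} → j ℕ.< i → + 0 ≤ f j) → + 0 ≤ f i
  step i below with i ℕ.<? L + e
  ... | yes i<L+e = window i i<L+e
  ... | no  i≮L+e with j , refl ← ℕP.m≤n⇒∃[o]m+o≡n (ℕP.≤-trans (ℕP.m≤n+m e L) (ℕP.≮⇒≥ i≮L+e)) =
    subst (+ 0 ≤_) (sym (periodic j L≤j)) (below (ℕP.m<n+m j (ℕ.>-nonZero⁻¹ e)))
    where
    L≤j : L ℕ.≤ j
    L≤j = ℕP.+-cancelˡ-≤ e L j (subst (ℕ._≤ e + j) (ℕP.+-comm L e) (ℕP.≮⇒≥ i≮L+e))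

coeff-≥length : ∀ p {i} → length p ℕ.≤ i → coeff p i ≡ + 0
coeff-≥length []                  _         = refl
coeff-≥length (a ∷ p) {suc i} (s≤s len≤i) = coeff-≥length p len≤i

coeff-⊛-geom-periodic : ∀ p e .{{_ : NonZero e}} i → length p ℕ.≤ i →
                        (coeff p ⊛ geom e) (e + i) ≡ (coeff p ⊛ geom e) i
coeff-⊛-geom-periodic p e i len≤i = ℤP.i-j≡0⇒i≡j _ _ (begin
  G (e + i) ℤ.- G i                   ≡⟨ cong (λ x → G (e + i) ℤ.- x) (sym (mono-⊛-+ e G i)) ⟩
  G (e + i) ℤ.- (mono e ⊛ G) (e + i)  ≡⟨ sym (oneMinus-⊛ e G (e + i)) ⟩
  (oneMinus e ⊛ G) (e + i)            ≡⟨ oneMinus-⊛-⊛-geom e (coeff p) (e + i) ⟩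
  coeff p (e + i)                     ≡⟨ coeff-≥length p (ℕP.≤-trans len≤i (ℕP.m≤n+m i e)) ⟩
  + 0                                 ∎)
  where
  open ≡-Reasoning
  G : Series
  G = coeff p ⊛ geom e

-- Certificates

oneMinusPoly : ℕ → ℤ[q].Poly
oneMinusPoly a = ℤ[q].X^ 0 ℤ[q].+ₚ ℤ[q].-ₚ ℤ[q].X^ a

denominator : List ℕ → ℤ[q].Poly
denominator = foldr (λ a d → oneMinusPoly a ℤ[q].*ₚ d) (ℤ[q].X^ 0)

⟦oneMinusPoly⟧ : ∀ a → ⟦ oneMinusPoly a ⟧ ≈ oneMinus a
⟦oneMinusPoly⟧ a = ≈-trans (⟦⟧.+-homo (ℤ[q].X^ 0) (ℤ[q].-ₚ ℤ[q].X^ a))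
                           (⊕-cong (⟦X^⟧ 0) (≈-trans (⟦⟧.-‿homo (ℤ[q].X^ a)) (⊝-cong (⟦X^⟧ a))))

geoms-⊛-denominator : ∀ {es} → All NonZero es → geoms es ⊛ ⟦ denominator es ⟧ ≈ oneS
geoms-⊛-denominator {[]}     []               = ≈-trans (⊛-identityˡ ⟦ ℤ[q].X^ 0 ⟧) (⟦X^⟧ 0)
geoms-⊛-denominator {e ∷ es} (e≢0 ∷ es≢0) = begin
  geom e ⊛ geoms es ⊛ ⟦ oneMinusPoly e ℤ[q].*ₚ denominator es ⟧
    ≈⟨ ⊛-cong (≈-refl {geom e ⊛ geoms es}) (≈-trans (⟦⟧.*-homo (oneMinusPoly e) (denominator es))
                                                     (⊛-cong (⟦oneMinusPoly⟧ e) (≈-refl {⟦ denominator es ⟧}))) ⟩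
  geom e ⊛ geoms es ⊛ (oneMinus e ⊛ ⟦ denominator es ⟧)
    ≈⟨ solve 4 (λ g h o d → g :* h :* (o :* d) := o :* g :* (h :* d))
             ≈-refl (geom e) (geoms es) (oneMinus e) ⟦ denominator es ⟧ ⟩
  oneMinus e ⊛ geom e ⊛ (geoms es ⊛ ⟦ denominator es ⟧)
    ≈⟨ ⊛-cong (oneMinus-⊛-geom e {{e≢0}}) (geoms-⊛-denominator es≢0) ⟩
  oneS ⊛ oneS
    ≈⟨ ⊛-identityˡ oneS ⟩
  oneS ∎
  where open ≈-Reasoning

record Certificate (k : ℕ) : Set where
  field
    σ₀ : ℤ[q].Poly
    σ₊ : ℤ[q][X].Poly
    period : ℕ
    exponents : List ℕ
    nonZero : All NonZero (period ∷ exponents)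
    gosper : All (All (_≡ + 0)) (gosperDefect k (σ₀ ∷ σ₊) (denominator (period ∷ exponents)))
    σ-at-1 : All (_≡ + 0) (sumCoeffs (σ₀ ∷ σ₊))
    window : All (λ i → + 0 ≤ (coeff (ℤ[q].-ₚ σ₀) ⊛ geom period) i) (upTo (length (ℤ[q].-ₚ σ₀) + period))

  c-nonNeg : ∀ m → + 0 ≤ c k m
  c-nonNeg m = subst (+ 0 ≤_) (sym (c≡ m)) (⊛-nonNeg (geoms-nonNeg exponents) quotient-nonNeg m)
    where
    open Telescoping k using (c-closed-form)
    numerator : ℤ[q].Poly
    numerator = ℤ[q].-ₚ σ₀
    instance
      period≢0 : NonZero period
      period≢0 = All.head nonZero
    quotient-nonNeg : NonNeg (coeff numerator ⊛ geom period)
    quotient-nonNeg = nonNeg-from-window _ period (length numerator)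
      (coeff-⊛-geom-periodic numerator period) (λ i → applyUpTo⁻ id _ window)
    c≡ : ∀ m → c k m ≡ (geoms exponents ⊛ (coeff numerator ⊛ geom period)) m
    c≡ m = trans (c-closed-form σ₀ σ₊ (denominator (period ∷ exponents)) gosper σ-at-1
                                 {geoms (period ∷ exponents)} (geoms-⊛-denominator nonZero) m)
                 (rearranged m)
      where
      open ≈-Reasoning
      rearranged : geom period ⊛ geoms exponents ⊛ ⊝ ⟦ σ₀ ⟧ ≈ geoms exponents ⊛ (coeff numerator ⊛ geom period)
      rearranged = begin
        geom period ⊛ geoms exponents ⊛ ⊝ ⟦ σ₀ ⟧
          ≈⟨ ⊛-cong (≈-refl {geom period ⊛ geoms exponents})
                    (≈-trans (≈-sym (⟦⟧.-‿homo σ₀)) (⟦⟧-coeff numerator)) ⟩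
        geom period ⊛ geoms exponents ⊛ coeff numerator
          ≈⟨ solve 3 (λ g h p → g :* h :* p := h :* (p :* g))
                   ≈-refl (geom period) (geoms exponents) (coeff numerator) ⟩
        geoms exponents ⊛ (coeff numerator ⊛ geom period) ∎

byComputation : ∀ {k} σ₀ σ₊ period exponents → All NonZero (period ∷ exponents) →
  {True (all? (all? (ℤ._≟ + 0)) (gosperDefect k (σ₀ ∷ σ₊) (denominator (period ∷ exponents))))} →
  {True (all? (ℤ._≟ + 0) (sumCoeffs (σ₀ ∷ σ₊)))} →
  {True (all? (λ i → + 0 ℤ.≤? (coeff (ℤ[q].-ₚ σ₀) ⊛ geom period) i) (upTo (length (ℤ[q].-ₚ σ₀) + period)))} →
  Certificate k
byComputation σ₀ σ₊ period exponents nonZero {gosper} {σ-at-1} {window} = record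
  { σ₀ = σ₀ ; σ₊ = σ₊ ; period = period ; exponents = exponents ; nonZero = nonZero
  ; gosper = toWitness gosper ; σ-at-1 = toWitness σ-at-1 ; window = toWitness window }

certificate₅ : Certificate 5
certificate₅ = byComputation
  (+ 0 ∷ -[1+ 0 ] ∷ -[1+ 1 ] ∷ -[1+ 2 ] ∷ -[1+ 2 ] ∷ -[1+ 3 ] ∷ -[1+ 2 ] ∷ -[1+ 1 ] ∷ + 0 ∷
      + 0 ∷ + 2 ∷ + 1 ∷ + 2 ∷ + 0 ∷ -[1+ 0 ] ∷ -[1+ 1 ] ∷ + 0 ∷ -[1+ 0 ] ∷ + 0 ∷ + 0 ∷ + 1 ∷ [])
  ((+ 0 ∷ + 1 ∷ + 2 ∷ + 4 ∷ + 5 ∷ + 7 ∷ + 8 ∷ + 9 ∷ + 7 ∷ + 9 ∷ + 7 ∷ + 7 ∷ + 5 ∷ + 5 ∷ + 3 ∷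
        + 4 ∷ -[1+ 0 ] ∷ + 0 ∷ -[1+ 1 ] ∷ -[1+ 0 ] ∷ -[1+ 1 ] ∷ + 0 ∷ + 1 ∷ + 2 ∷ + 0 ∷ + 1 ∷ + 0 ∷
        + 0 ∷ -[1+ 0 ] ∷ [])
  ∷ (+ 0 ∷ + 0 ∷ + 0 ∷ -[1+ 0 ] ∷ -[1+ 1 ] ∷ -[1+ 2 ] ∷ -[1+ 4 ] ∷ -[1+ 7 ] ∷ -[1+ 8 ] ∷
        -[1+ 11 ] ∷ -[1+ 13 ] ∷ -[1+ 14 ] ∷ -[1+ 15 ] ∷ -[1+ 15 ] ∷ -[1+ 12 ] ∷ -[1+ 13 ] ∷
        -[1+ 9 ] ∷ -[1+ 7 ] ∷ -[1+ 5 ] ∷ -[1+ 3 ] ∷ -[1+ 1 ] ∷ -[1+ 0 ] ∷ + 0 ∷ -[1+ 1 ] ∷ + 1 ∷ [])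
  ∷ (+ 0 ∷ + 0 ∷ + 0 ∷ + 0 ∷ + 0 ∷ + 0 ∷ + 0 ∷ + 1 ∷ + 2 ∷ + 3 ∷ + 5 ∷ + 7 ∷ + 9 ∷ + 12 ∷ + 13 ∷
        + 15 ∷ + 16 ∷ + 15 ∷ + 15 ∷ + 13 ∷ + 11 ∷ + 9 ∷ + 5 ∷ + 5 ∷ + 3 ∷ + 0 ∷ + 1 ∷ [])
  ∷ (+ 0 ∷ + 0 ∷ + 0 ∷ + 0 ∷ + 0 ∷ + 0 ∷ + 0 ∷ + 0 ∷ + 0 ∷ + 0 ∷ + 0 ∷ + 0 ∷ + 0 ∷ -[1+ 0 ] ∷
        -[1+ 1 ] ∷ -[1+ 2 ] ∷ -[1+ 4 ] ∷ -[1+ 5 ] ∷ -[1+ 6 ] ∷ -[1+ 7 ] ∷ -[1+ 7 ] ∷ -[1+ 8 ] ∷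
        -[1+ 7 ] ∷ -[1+ 6 ] ∷ -[1+ 6 ] ∷ -[1+ 3 ] ∷ -[1+ 2 ] ∷ -[1+ 1 ] ∷ [])
  ∷ (+ 0 ∷ + 0 ∷ + 0 ∷ + 0 ∷ + 0 ∷ + 0 ∷ + 0 ∷ + 0 ∷ + 0 ∷ + 0 ∷ + 0 ∷ + 0 ∷ + 0 ∷ + 0 ∷ + 0 ∷
        + 0 ∷ + 0 ∷ + 0 ∷ + 0 ∷ + 0 ∷ + 0 ∷ + 1 ∷ + 2 ∷ + 2 ∷ + 3 ∷ + 3 ∷ + 2 ∷ + 2 ∷ + 1 ∷ []) ∷ [])
  3 (5 ∷ 5 ∷ 7 ∷ 7 ∷ []) (_ ∷ _ ∷ _ ∷ _ ∷ _ ∷ [])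

certificate₆ : Certificate 6
certificate₆ = byComputation
  (+ 0 ∷ -[1+ 0 ] ∷ -[1+ 1 ] ∷ -[1+ 2 ] ∷ -[1+ 3 ] ∷ -[1+ 5 ] ∷ -[1+ 6 ] ∷ -[1+ 7 ] ∷ -[1+ 8 ] ∷
      -[1+ 9 ] ∷ -[1+ 7 ] ∷ -[1+ 8 ] ∷ -[1+ 7 ] ∷ -[1+ 6 ] ∷ -[1+ 7 ] ∷ -[1+ 7 ] ∷ -[1+ 3 ] ∷
      -[1+ 6 ] ∷ -[1+ 5 ] ∷ -[1+ 3 ] ∷ -[1+ 3 ] ∷ -[1+ 3 ] ∷ + 1 ∷ -[1+ 0 ] ∷ + 0 ∷ + 1 ∷ + 0 ∷
      -[1+ 0 ] ∷ + 1 ∷ -[1+ 1 ] ∷ -[1+ 0 ] ∷ -[1+ 1 ] ∷ + 0 ∷ + 0 ∷ + 0 ∷ + 1 ∷ + 2 ∷ + 0 ∷ + 1 ∷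
      + 0 ∷ + 0 ∷ + 0 ∷ + 0 ∷ -[1+ 0 ] ∷ [])
  ((+ 0 ∷ + 1 ∷ + 2 ∷ + 4 ∷ + 6 ∷ + 9 ∷ + 13 ∷ + 17 ∷ + 20 ∷ + 27 ∷ + 29 ∷ + 33 ∷ + 39 ∷ + 41 ∷
        + 43 ∷ + 50 ∷ + 46 ∷ + 48 ∷ + 49 ∷ + 46 ∷ + 41 ∷ + 41 ∷ + 33 ∷ + 28 ∷ + 25 ∷ + 22 ∷ + 13 ∷
        + 15 ∷ + 9 ∷ + 7 ∷ + 5 ∷ + 5 ∷ + 0 ∷ + 0 ∷ + 0 ∷ + 0 ∷ -[1+ 1 ] ∷ + 2 ∷ -[1+ 0 ] ∷ + 2 ∷
        + 1 ∷ + 2 ∷ + 0 ∷ + 0 ∷ + 0 ∷ -[1+ 0 ] ∷ -[1+ 1 ] ∷ + 0 ∷ -[1+ 0 ] ∷ + 0 ∷ + 0 ∷ + 0 ∷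
        + 0 ∷ + 1 ∷ [])
  ∷ (+ 0 ∷ + 0 ∷ + 0 ∷ -[1+ 0 ] ∷ -[1+ 1 ] ∷ -[1+ 2 ] ∷ -[1+ 5 ] ∷ -[1+ 9 ] ∷ -[1+ 12 ] ∷
        -[1+ 19 ] ∷ -[1+ 26 ] ∷ -[1+ 32 ] ∷ -[1+ 43 ] ∷ -[1+ 53 ] ∷ -[1+ 59 ] ∷ -[1+ 73 ] ∷
        -[1+ 82 ] ∷ -[1+ 88 ] ∷ -[1+ 98 ] ∷ -[1+ 105 ] ∷ -[1+ 106 ] ∷ -[1+ 110 ] ∷ -[1+ 112 ] ∷
        -[1+ 108 ] ∷ -[1+ 103 ] ∷ -[1+ 103 ] ∷ -[1+ 89 ] ∷ -[1+ 83 ] ∷ -[1+ 77 ] ∷ -[1+ 63 ] ∷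
        -[1+ 54 ] ∷ -[1+ 46 ] ∷ -[1+ 36 ] ∷ -[1+ 28 ] ∷ -[1+ 19 ] ∷ -[1+ 17 ] ∷ -[1+ 8 ] ∷
        -[1+ 7 ] ∷ -[1+ 4 ] ∷ -[1+ 1 ] ∷ -[1+ 0 ] ∷ -[1+ 0 ] ∷ -[1+ 0 ] ∷ + 1 ∷ + 0 ∷ -[1+ 0 ] ∷
        + 2 ∷ -[1+ 0 ] ∷ [])
  ∷ (+ 0 ∷ + 0 ∷ + 0 ∷ + 0 ∷ + 0 ∷ + 0 ∷ + 0 ∷ + 1 ∷ + 2 ∷ + 3 ∷ + 6 ∷ + 9 ∷ + 13 ∷ + 21 ∷
        + 27 ∷ + 35 ∷ + 47 ∷ + 57 ∷ + 69 ∷ + 83 ∷ + 95 ∷ + 106 ∷ + 118 ∷ + 130 ∷ + 134 ∷ + 142 ∷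
        + 147 ∷ + 143 ∷ + 145 ∷ + 140 ∷ + 131 ∷ + 123 ∷ + 113 ∷ + 103 ∷ + 86 ∷ + 77 ∷ + 64 ∷ + 49 ∷
        + 44 ∷ + 31 ∷ + 22 ∷ + 16 ∷ + 12 ∷ + 8 ∷ + 3 ∷ + 4 ∷ + 0 ∷ + 0 ∷ + 2 ∷ -[1+ 0 ] ∷ [])
  ∷ (+ 0 ∷ + 0 ∷ + 0 ∷ + 0 ∷ + 0 ∷ + 0 ∷ + 0 ∷ + 0 ∷ + 0 ∷ + 0 ∷ + 0 ∷ + 0 ∷ + 0 ∷ -[1+ 0 ] ∷
        -[1+ 1 ] ∷ -[1+ 2 ] ∷ -[1+ 5 ] ∷ -[1+ 8 ] ∷ -[1+ 12 ] ∷ -[1+ 18 ] ∷ -[1+ 24 ] ∷ -[1+ 32 ] ∷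
        -[1+ 40 ] ∷ -[1+ 50 ] ∷ -[1+ 60 ] ∷ -[1+ 68 ] ∷ -[1+ 80 ] ∷ -[1+ 88 ] ∷ -[1+ 95 ] ∷
        -[1+ 103 ] ∷ -[1+ 107 ] ∷ -[1+ 110 ] ∷ -[1+ 109 ] ∷ -[1+ 111 ] ∷ -[1+ 106 ] ∷ -[1+ 98 ] ∷
        -[1+ 97 ] ∷ -[1+ 84 ] ∷ -[1+ 75 ] ∷ -[1+ 69 ] ∷ -[1+ 56 ] ∷ -[1+ 46 ] ∷ -[1+ 38 ] ∷
        -[1+ 31 ] ∷ -[1+ 20 ] ∷ -[1+ 16 ] ∷ -[1+ 12 ] ∷ -[1+ 4 ] ∷ -[1+ 5 ] ∷ -[1+ 2 ] ∷ + 0 ∷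
        -[1+ 0 ] ∷ [])
  ∷ (+ 0 ∷ + 0 ∷ + 0 ∷ + 0 ∷ + 0 ∷ + 0 ∷ + 0 ∷ + 0 ∷ + 0 ∷ + 0 ∷ + 0 ∷ + 0 ∷ + 0 ∷ + 0 ∷ + 0 ∷
        + 0 ∷ + 0 ∷ + 0 ∷ + 0 ∷ + 0 ∷ + 0 ∷ + 1 ∷ + 2 ∷ + 3 ∷ + 6 ∷ + 8 ∷ + 11 ∷ + 16 ∷ + 19 ∷
        + 23 ∷ + 28 ∷ + 33 ∷ + 36 ∷ + 40 ∷ + 45 ∷ + 44 ∷ + 48 ∷ + 50 ∷ + 45 ∷ + 46 ∷ + 44 ∷ + 39 ∷
        + 36 ∷ + 33 ∷ + 27 ∷ + 22 ∷ + 21 ∷ + 14 ∷ + 10 ∷ + 9 ∷ + 4 ∷ + 3 ∷ + 2 ∷ [])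
  ∷ (+ 0 ∷ + 0 ∷ + 0 ∷ + 0 ∷ + 0 ∷ + 0 ∷ + 0 ∷ + 0 ∷ + 0 ∷ + 0 ∷ + 0 ∷ + 0 ∷ + 0 ∷ + 0 ∷ + 0 ∷
        + 0 ∷ + 0 ∷ + 0 ∷ + 0 ∷ + 0 ∷ + 0 ∷ + 0 ∷ + 0 ∷ + 0 ∷ + 0 ∷ + 0 ∷ + 0 ∷ + 0 ∷ + 0 ∷ + 0 ∷
        + 0 ∷ -[1+ 0 ] ∷ -[1+ 1 ] ∷ -[1+ 1 ] ∷ -[1+ 3 ] ∷ -[1+ 4 ] ∷ -[1+ 4 ] ∷ -[1+ 7 ] ∷
        -[1+ 7 ] ∷ -[1+ 6 ] ∷ -[1+ 8 ] ∷ -[1+ 8 ] ∷ -[1+ 7 ] ∷ -[1+ 8 ] ∷ -[1+ 8 ] ∷ -[1+ 6 ] ∷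
        -[1+ 7 ] ∷ -[1+ 7 ] ∷ -[1+ 4 ] ∷ -[1+ 4 ] ∷ -[1+ 3 ] ∷ -[1+ 1 ] ∷ -[1+ 1 ] ∷ -[1+ 0 ] ∷ []) ∷ [])
  5 (7 ∷ 7 ∷ 9 ∷ 9 ∷ 15 ∷ []) (_ ∷ _ ∷ _ ∷ _ ∷ _ ∷ _ ∷ [])

certificate₇ : Certificate 7
certificate₇ = byComputation
  (+ 0 ∷ -[1+ 0 ] ∷ -[1+ 1 ] ∷ -[1+ 2 ] ∷ -[1+ 3 ] ∷ -[1+ 5 ] ∷ -[1+ 7 ] ∷ -[1+ 9 ] ∷
      -[1+ 11 ] ∷ -[1+ 13 ] ∷ -[1+ 13 ] ∷ -[1+ 16 ] ∷ -[1+ 15 ] ∷ -[1+ 15 ] ∷ -[1+ 17 ] ∷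
      -[1+ 15 ] ∷ -[1+ 12 ] ∷ -[1+ 14 ] ∷ -[1+ 10 ] ∷ -[1+ 11 ] ∷ -[1+ 9 ] ∷ -[1+ 7 ] ∷ -[1+ 5 ] ∷
      -[1+ 6 ] ∷ -[1+ 3 ] ∷ -[1+ 3 ] ∷ -[1+ 2 ] ∷ -[1+ 3 ] ∷ + 0 ∷ -[1+ 2 ] ∷ + 0 ∷ -[1+ 1 ] ∷
      -[1+ 0 ] ∷ -[1+ 0 ] ∷ + 0 ∷ -[1+ 1 ] ∷ + 2 ∷ + 0 ∷ + 1 ∷ + 0 ∷ + 2 ∷ + 2 ∷ + 4 ∷ -[1+ 0 ] ∷
      + 1 ∷ + 0 ∷ + 0 ∷ + 0 ∷ -[1+ 0 ] ∷ -[1+ 1 ] ∷ + 0 ∷ -[1+ 1 ] ∷ + 0 ∷ + 0 ∷ + 0 ∷ + 0 ∷ + 0 ∷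
      + 0 ∷ + 1 ∷ [])
  ((+ 0 ∷ + 1 ∷ + 2 ∷ + 4 ∷ + 6 ∷ + 9 ∷ + 14 ∷ + 19 ∷ + 24 ∷ + 33 ∷ + 38 ∷ + 47 ∷ + 56 ∷ + 62 ∷
        + 72 ∷ + 82 ∷ + 83 ∷ + 93 ∷ + 96 ∷ + 99 ∷ + 101 ∷ + 101 ∷ + 95 ∷ + 94 ∷ + 87 ∷ + 80 ∷
        + 71 ∷ + 68 ∷ + 50 ∷ + 48 ∷ + 38 ∷ + 30 ∷ + 25 ∷ + 19 ∷ + 11 ∷ + 14 ∷ + 5 ∷ + 6 ∷ + 2 ∷
        + 6 ∷ + 0 ∷ + 3 ∷ -[1+ 1 ] ∷ + 2 ∷ + 2 ∷ + 1 ∷ + 0 ∷ + 2 ∷ -[1+ 2 ] ∷ + 2 ∷ -[1+ 1 ] ∷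
        + 0 ∷ -[1+ 1 ] ∷ -[1+ 1 ] ∷ -[1+ 3 ] ∷ + 1 ∷ -[1+ 0 ] ∷ + 0 ∷ + 0 ∷ + 0 ∷ + 1 ∷ + 2 ∷ + 0 ∷
        + 2 ∷ + 0 ∷ + 0 ∷ + 0 ∷ + 0 ∷ + 0 ∷ + 0 ∷ -[1+ 0 ] ∷ [])
  ∷ (+ 0 ∷ + 0 ∷ + 0 ∷ -[1+ 0 ] ∷ -[1+ 1 ] ∷ -[1+ 2 ] ∷ -[1+ 5 ] ∷ -[1+ 9 ] ∷ -[1+ 13 ] ∷
        -[1+ 21 ] ∷ -[1+ 29 ] ∷ -[1+ 38 ] ∷ -[1+ 53 ] ∷ -[1+ 67 ] ∷ -[1+ 81 ] ∷ -[1+ 104 ] ∷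
        -[1+ 121 ] ∷ -[1+ 141 ] ∷ -[1+ 166 ] ∷ -[1+ 184 ] ∷ -[1+ 204 ] ∷ -[1+ 226 ] ∷ -[1+ 239 ] ∷
        -[1+ 254 ] ∷ -[1+ 265 ] ∷ -[1+ 271 ] ∷ -[1+ 270 ] ∷ -[1+ 275 ] ∷ -[1+ 265 ] ∷ -[1+ 254 ] ∷
        -[1+ 246 ] ∷ -[1+ 225 ] ∷ -[1+ 209 ] ∷ -[1+ 193 ] ∷ -[1+ 164 ] ∷ -[1+ 149 ] ∷ -[1+ 126 ] ∷
        -[1+ 108 ] ∷ -[1+ 86 ] ∷ -[1+ 73 ] ∷ -[1+ 55 ] ∷ -[1+ 42 ] ∷ -[1+ 35 ] ∷ -[1+ 21 ] ∷
        -[1+ 16 ] ∷ -[1+ 12 ] ∷ -[1+ 3 ] ∷ -[1+ 8 ] ∷ + 0 ∷ -[1+ 1 ] ∷ + 0 ∷ + 0 ∷ -[1+ 0 ] ∷ + 0 ∷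
        + 2 ∷ + 0 ∷ -[1+ 0 ] ∷ + 0 ∷ + 0 ∷ + 0 ∷ + 1 ∷ -[1+ 1 ] ∷ + 1 ∷ [])
  ∷ (+ 0 ∷ + 0 ∷ + 0 ∷ + 0 ∷ + 0 ∷ + 0 ∷ + 0 ∷ + 1 ∷ + 2 ∷ + 3 ∷ + 6 ∷ + 9 ∷ + 14 ∷ + 23 ∷
        + 30 ∷ + 42 ∷ + 58 ∷ + 73 ∷ + 96 ∷ + 120 ∷ + 144 ∷ + 175 ∷ + 205 ∷ + 238 ∷ + 271 ∷ + 304 ∷
        + 333 ∷ + 362 ∷ + 391 ∷ + 407 ∷ + 426 ∷ + 436 ∷ + 437 ∷ + 442 ∷ + 428 ∷ + 416 ∷ + 397 ∷
        + 373 ∷ + 348 ∷ + 314 ∷ + 286 ∷ + 248 ∷ + 220 ∷ + 189 ∷ + 155 ∷ + 133 ∷ + 100 ∷ + 85 ∷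
        + 66 ∷ + 47 ∷ + 38 ∷ + 22 ∷ + 19 ∷ + 12 ∷ + 8 ∷ + 4 ∷ + 2 ∷ + 2 ∷ -[1+ 0 ] ∷ + 2 ∷
        -[1+ 0 ] ∷ + 0 ∷ + 1 ∷ -[1+ 1 ] ∷ + 1 ∷ [])
  ∷ (+ 0 ∷ + 0 ∷ + 0 ∷ + 0 ∷ + 0 ∷ + 0 ∷ + 0 ∷ + 0 ∷ + 0 ∷ + 0 ∷ + 0 ∷ + 0 ∷ + 0 ∷ -[1+ 0 ] ∷
        -[1+ 1 ] ∷ -[1+ 2 ] ∷ -[1+ 5 ] ∷ -[1+ 8 ] ∷ -[1+ 13 ] ∷ -[1+ 21 ] ∷ -[1+ 29 ] ∷ -[1+ 41 ] ∷
        -[1+ 55 ] ∷ -[1+ 72 ] ∷ -[1+ 93 ] ∷ -[1+ 116 ] ∷ -[1+ 143 ] ∷ -[1+ 170 ] ∷ -[1+ 202 ] ∷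
        -[1+ 234 ] ∷ -[1+ 266 ] ∷ -[1+ 301 ] ∷ -[1+ 328 ] ∷ -[1+ 360 ] ∷ -[1+ 385 ] ∷ -[1+ 405 ] ∷
        -[1+ 425 ] ∷ -[1+ 431 ] ∷ -[1+ 440 ] ∷ -[1+ 437 ] ∷ -[1+ 430 ] ∷ -[1+ 418 ] ∷ -[1+ 396 ] ∷
        -[1+ 377 ] ∷ -[1+ 346 ] ∷ -[1+ 321 ] ∷ -[1+ 285 ] ∷ -[1+ 251 ] ∷ -[1+ 224 ] ∷ -[1+ 185 ] ∷
        -[1+ 163 ] ∷ -[1+ 130 ] ∷ -[1+ 103 ] ∷ -[1+ 85 ] ∷ -[1+ 63 ] ∷ -[1+ 51 ] ∷ -[1+ 34 ] ∷
        -[1+ 25 ] ∷ -[1+ 15 ] ∷ -[1+ 11 ] ∷ -[1+ 9 ] ∷ -[1+ 1 ] ∷ -[1+ 3 ] ∷ + 0 ∷ + 0 ∷ -[1+ 1 ] ∷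
        + 1 ∷ [])
  ∷ (+ 0 ∷ + 0 ∷ + 0 ∷ + 0 ∷ + 0 ∷ + 0 ∷ + 0 ∷ + 0 ∷ + 0 ∷ + 0 ∷ + 0 ∷ + 0 ∷ + 0 ∷ + 0 ∷ + 0 ∷
        + 0 ∷ + 0 ∷ + 0 ∷ + 0 ∷ + 0 ∷ + 0 ∷ + 1 ∷ + 2 ∷ + 3 ∷ + 6 ∷ + 9 ∷ + 14 ∷ + 21 ∷ + 28 ∷
        + 38 ∷ + 50 ∷ + 65 ∷ + 80 ∷ + 98 ∷ + 118 ∷ + 136 ∷ + 161 ∷ + 180 ∷ + 199 ∷ + 221 ∷ + 235 ∷
        + 252 ∷ + 263 ∷ + 270 ∷ + 272 ∷ + 274 ∷ + 271 ∷ + 257 ∷ + 252 ∷ + 231 ∷ + 214 ∷ + 201 ∷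
        + 172 ∷ + 155 ∷ + 133 ∷ + 112 ∷ + 94 ∷ + 76 ∷ + 60 ∷ + 44 ∷ + 38 ∷ + 24 ∷ + 17 ∷ + 14 ∷
        + 5 ∷ + 6 ∷ + 3 ∷ + 0 ∷ + 1 ∷ [])
  ∷ (+ 0 ∷ + 0 ∷ + 0 ∷ + 0 ∷ + 0 ∷ + 0 ∷ + 0 ∷ + 0 ∷ + 0 ∷ + 0 ∷ + 0 ∷ + 0 ∷ + 0 ∷ + 0 ∷ + 0 ∷
        + 0 ∷ + 0 ∷ + 0 ∷ + 0 ∷ + 0 ∷ + 0 ∷ + 0 ∷ + 0 ∷ + 0 ∷ + 0 ∷ + 0 ∷ + 0 ∷ + 0 ∷ + 0 ∷ + 0 ∷
        + 0 ∷ -[1+ 0 ] ∷ -[1+ 1 ] ∷ -[1+ 2 ] ∷ -[1+ 5 ] ∷ -[1+ 7 ] ∷ -[1+ 11 ] ∷ -[1+ 17 ] ∷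
        -[1+ 21 ] ∷ -[1+ 28 ] ∷ -[1+ 35 ] ∷ -[1+ 42 ] ∷ -[1+ 51 ] ∷ -[1+ 60 ] ∷ -[1+ 67 ] ∷
        -[1+ 74 ] ∷ -[1+ 84 ] ∷ -[1+ 87 ] ∷ -[1+ 94 ] ∷ -[1+ 99 ] ∷ -[1+ 95 ] ∷ -[1+ 100 ] ∷
        -[1+ 97 ] ∷ -[1+ 92 ] ∷ -[1+ 90 ] ∷ -[1+ 81 ] ∷ -[1+ 74 ] ∷ -[1+ 67 ] ∷ -[1+ 60 ] ∷
        -[1+ 49 ] ∷ -[1+ 42 ] ∷ -[1+ 35 ] ∷ -[1+ 25 ] ∷ -[1+ 23 ] ∷ -[1+ 15 ] ∷ -[1+ 9 ] ∷
        -[1+ 8 ] ∷ -[1+ 3 ] ∷ -[1+ 2 ] ∷ -[1+ 1 ] ∷ [])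
  ∷ (+ 0 ∷ + 0 ∷ + 0 ∷ + 0 ∷ + 0 ∷ + 0 ∷ + 0 ∷ + 0 ∷ + 0 ∷ + 0 ∷ + 0 ∷ + 0 ∷ + 0 ∷ + 0 ∷ + 0 ∷
        + 0 ∷ + 0 ∷ + 0 ∷ + 0 ∷ + 0 ∷ + 0 ∷ + 0 ∷ + 0 ∷ + 0 ∷ + 0 ∷ + 0 ∷ + 0 ∷ + 0 ∷ + 0 ∷ + 0 ∷
        + 0 ∷ + 0 ∷ + 0 ∷ + 0 ∷ + 0 ∷ + 0 ∷ + 0 ∷ + 0 ∷ + 0 ∷ + 0 ∷ + 0 ∷ + 0 ∷ + 0 ∷ + 1 ∷ + 2 ∷
        + 2 ∷ + 4 ∷ + 5 ∷ + 6 ∷ + 10 ∷ + 10 ∷ + 11 ∷ + 14 ∷ + 14 ∷ + 16 ∷ + 17 ∷ + 16 ∷ + 16 ∷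
        + 17 ∷ + 16 ∷ + 14 ∷ + 14 ∷ + 11 ∷ + 10 ∷ + 10 ∷ + 6 ∷ + 5 ∷ + 4 ∷ + 2 ∷ + 2 ∷ + 1 ∷ []) ∷ [])
  7 (7 ∷ 9 ∷ 9 ∷ 11 ∷ 11 ∷ 15 ∷ []) (_ ∷ _ ∷ _ ∷ _ ∷ _ ∷ _ ∷ _ ∷ [])

theorem1p2 : (k : ℕ) → (k ≡ 5 ⊎ k ≡ 6 ⊎ k ≡ 7) → (m : ℕ) → + 0 ≤ c k m
theorem1p2 _ (inj₁ refl)        = Certificate.c-nonNeg certificate₅
theorem1p2 _ (inj₂ (inj₁ refl)) = Certificate.c-nonNeg certificate₆
theorem1p2 _ (inj₂ (inj₂ refl)) = Certificate.c-nonNeg certificate₇
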